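{- Let $\phi$ be a Drinfeld module of rank $r$ over $\mathbb{C}_\infty$ given by $\phi_T=T+\sum_{i=1}^rA_i\tau^i$, $A_r\ne0$, and write its logarithm as $\log_\phi(z)=\sum_{n=0}^\infty\beta_nz^{q^n}$. For $\mathbf{S}=(S_1,\dots,S_r)\in P_r(n)$ set \[L(\mathbf{S}):=\prod_{j=1}^r\prod_{i\in S_j}(-[i+j]).\] Then for all $n\ge0$, \[\beta_n=\sum_{\mathbf{S}\in P_r(n)}\frac{\mathbf{A}^{\mathbf{S}}}{L(\mathbf{S})}.\]
   Context: Let $q$ be a prime power, $\mathbb{A}=\mathbb{F}_q[T]$, $v$ the valuation with $v(T)=-1$, $\mathbb{C}_\infty$ the completion of an algebraic closure of the $v$-adic completion of $\mathbb{F}_q(T)$. A rank $r$ Drinfeld module $\phi$ is an $\mathbb{F}_q$-linear ring homomorphism $\mathbb{A}\to\mathbb{C}_\infty\{\tau\}$ ($\tau$ the $q$-Frobenius, $\tau\ell=\ell^q\tau$) with $\phi_T=T+\sum_{i=1}^rA_i\tau^i$, $A_r\neq 0$. Its exponential $e_\phi(z)=z+\sum_{n\ge1}\alpha_nz^{q^n}$ satisfies $e_\phi(Tz)=\phi_T(e_\phi(z))$, and its logarithm $\log_\phi(z)=\sum_{n\ge0}\beta_nz^{q^n}$ ($\beta_0=1$) is the composition inverse power series of $e_\phi$; it satisfies $T\log_\phi(z)=\log_\phi(\phi_T(z))$. Notation: $[n]:=T^{q^n}-T$; for finite $S\subset\mathbb{N}$, $w(S)=\sum_{i\in S}q^i$;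 for $\mathbf{S}=(S_1,\dots,S_r)$, $\mathbf{A}^{\mathbf{S}}=\prod_iA_i^{w(S_i)}$. For $n>0$, $P_r(n)$ is the set of $r$-tuples $(S_1,\dots,S_r)$ of subsets of $\{0,\dots,n-1\}$ such that the sets $S_i+j:=\{s+j:s\in S_i\}$, $1\le i\le r$, $0\le j\le i-1$, form a partition of $\{0,\dots,n-1\}$; $P_r(0)$ consists only of the tuple of empty sets. Empty products equal $1$. -}

module Defs where

open import Level using (Level; _⊔_)
open import Algebra.Bundles using (CommutativeRing)
open import Data.Nat as ℕ using (ℕ; zero; suc; _∸_; _≤ᵇ_)
open import Data.Bool using (Bool; true; false; _∧_; if_then_else_)
open import Data.Fin using (Fin; toℕ)
open import Data.Vec using (Vec; []; _∷_; lookup)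
open import Data.List using (List; []; _∷_; _++_; map; concatMap; filter; foldr; allFin; upTo)
open import Relation.Nullary using (¬_)
open import Relation.Binary.PropositionalEquality using (_≡_)

record Field (c ℓ : Level) : Set (Level.suc (c ⊔ ℓ)) where
  field
    commutativeRing : CommutativeRing c ℓ
  open CommutativeRing commutativeRing public
  field
    _⁻¹        : Carrier → Carrier
    1≉0        : ¬ (1# ≈ 0#)
    ⁻¹-inverse : ∀ x → ¬ (x ≈ 0#) → (x * (x ⁻¹)) ≈ 1#

-- Finite subsets of {0,…,n-1}: Vec Bool n (as Data.Fin.Subset.Subset n),
-- with membership of a natural number (false out of range).

mem : ∀ {n} → Vec Bool n → ℕ → Bool
mem []          _       = false
mem (b ∷ bs)    zero    = b
mem (b ∷ bs)    (suc k) = mem bs k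

elems : ∀ {n} → Vec Bool n → List ℕ
elems []            = []
elems (true  ∷ bs)  = 0 ∷ map suc (elems bs)
elems (false ∷ bs)  = map suc (elems bs)

allSubsets : (n : ℕ) → List (Vec Bool n)
allSubsets zero    = [] ∷ []
allSubsets (suc n) = map (true ∷_) (allSubsets n) ++ map (false ∷_) (allSubsets n)

allTuples : (r n : ℕ) → List (Vec (Vec Bool n) r)
allTuples zero    n = [] ∷ []
allTuples (suc r) n =
  concatMap (λ S → map (S ∷_) (allTuples r n)) (allSubsets n)

-- Index convention: position idx : Fin r of the tuple is S_i with
-- i = toℕ idx + 1  (so i ranges over 1,…,r).

countCover : ∀ {r n} → Vec (Vec Bool n) r → ℕ → ℕ
countCover {r} 𝐒 k =
  Data.Nat.ListAction.sum (map (λ idx →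
    Data.Nat.ListAction.sum (map (λ j → if (j ≤ᵇ k) ∧ mem (lookup 𝐒 idx) (k ∸ j) then 1 else 0)
                       (upTo (suc (toℕ idx)))))
    (allFin r))
  where import Data.Nat.ListAction

boolAll : List Bool → Bool
boolAll = foldr _∧_ true

inRange : ∀ {r n} → Vec (Vec Bool n) r → Bool
inRange {r} {n} 𝐒 =
  boolAll (map (λ idx →
    boolAll (map (λ s → (s ℕ.+ suc (toℕ idx)) ≤ᵇ n) (elems (lookup 𝐒 idx))))
    (allFin r))

coveredOnce : ∀ {r n} → Vec (Vec Bool n) r → Bool
coveredOnce {r} {n} 𝐒 = boolAll (map (λ k → countCover 𝐒 k ℕ.≡ᵇ 1) (upTo n))

-- (S₁,…,S_r) ∈ P_r(n): the family (S_i + j)_{1≤i≤r, 0≤j≤i-1} is a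
-- partition of {0,…,n-1} (blocks may be empty)
isInP : ∀ {r n} → Vec (Vec Bool n) r → Bool
isInP 𝐒 = inRange 𝐒 ∧ coveredOnce 𝐒

P : (r n : ℕ) → List (Vec (Vec Bool n) r)
P r n = filter (λ 𝐒 → Data.Bool.T? (isInP 𝐒)) (allTuples r n)
  where import Data.Bool

w : ∀ {n} → ℕ → Vec Bool n → ℕ
w q S = Data.Nat.ListAction.sum (map (λ i → q ℕ.^ i) (elems S))
  where import Data.Nat.ListAction

module RingNotions {c ℓ} (R : CommutativeRing c ℓ) where
  open CommutativeRing R

  pow : Carrier → ℕ → Carrier
  pow x zero    = 1#
  pow x (suc m) = x * pow x m

  sumL : List Carrier → Carrier
  sumL = foldr _+_ 0#

  prodL : List Carrier → Carrier
  prodL = foldr _*_ 1#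

  sumBelow : ℕ → (ℕ → Carrier) → Carrier
  sumBelow m f = sumL (map f (upTo m))

  bracket : ℕ → Carrier → ℕ → Carrier
  bracket q T n = pow T (q ℕ.^ n) - T

  Apow : ∀ {r n} → ℕ → (Fin r → Carrier) → Vec (Vec Bool n) r → Carrier
  Apow {r} q A 𝐒 = prodL (map (λ idx → pow (A idx) (w q (lookup 𝐒 idx))) (allFin r))

  Lden : ∀ {r n} → ℕ → Carrier → Vec (Vec Bool n) r → Carrier
  Lden {r} q T 𝐒 =
    prodL (map (λ idx →
      prodL (map (λ i → - bracket q T (i ℕ.+ suc (toℕ idx))) (elems (lookup 𝐒 idx))))
      (allFin r))

  -- coefficient a of z^{q^k} of φ_T = T + Σ_{i=1}^r A_i τ^i is A_i
  -- (A given as Fin r → Carrier, A (idx) = A_{idx+1}).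
  -- Functional equation e_φ(Tz) = φ_T(e_φ(z)) on the coefficient of z^{q^n}:
  --   α_n T^{q^n} = T α_n + Σ_{i=1}^{min(r,n)} A_i α_{n-i}^{q^i}
  ExpEquation : ∀ {r} → ℕ → Carrier → (Fin r → Carrier) → (ℕ → Carrier) → Set ℓ
  ExpEquation {r} q T A α =
    ∀ n → (α n * pow T (q ℕ.^ n))
          ≈ (T * α n + sumL (map (λ idx →
                 if suc (toℕ idx) ≤ᵇ n
                 then A idx * pow (α (n ∸ suc (toℕ idx))) (q ℕ.^ suc (toℕ idx))
                 else 0#) (allFin r)))

  -- log_φ ∘ e_φ = z : the coefficient of z^{q^n} of Σ_m β_m (Σ_k α_k z^{q^k})^{q^m}
  -- is Σ_{m=0}^{n} β_m α_{n-m}^{q^m}; it must be 1 for n = 0 and 0 for n ≥ 1.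
  IsCompInverse : ℕ → (ℕ → Carrier) → (ℕ → Carrier) → Set ℓ
  IsCompInverse q α β =
    ∀ n → sumBelow (suc n) (λ m → β m * pow (α (n ∸ m)) (q ℕ.^ m))
          ≈ (if n ℕ.≡ᵇ 0 then 1# else 0#)

module Submission where

-- For weights G, H (here G_j(i) = A_j^{q^i} and H_j(i) = -[i+j]) put
--   E(n) = Σ_{𝐒 ∈ P_r(n)} Π_j Π_{i ∈ S_j} G_j(i) / H_j(i).
-- A tuple 𝐒 ∈ P_r(n) is a partition of {0,…,n-1} into blocks S_j + (0,…,j-1).
--  * Removing the block through 0 gives a recursion on the first element
--    (FirstElement); it is proved by peeling off the column recording which
--    S_j contain 0 (Partitions for the combinatorics, TupleSums for sums).
--  * By strong induction it turns into the recursion on the last element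
--    (LastElement), which for the theorem's weights is the functional
--    equation T·log_φ(z) = log_φ(φ_T(z)), coefficientwise (LogCoefficients).
--  * Together with the equation e_φ(Tz) = φ_T(e_φ(z)) and the additivity of
--    the q-Frobenius in characteristic p (Binomial), the E(n) satisfy the
--    equations of the composition inverse of e_φ (CompositionInverse).
--  * These equations determine β uniquely, so β_n = E(n) (theorem3p3).

open import Defs
open import Data.Nat using (ℕ)

module Prelude where

  open import Data.Nat using (zero; suc; _+_; _∸_; _≤ᵇ_; _<ᵇ_; _≡ᵇ_; _≤_; _<_)
  import Data.Nat.Properties as ℕP
  open import Data.Bool using (true; false; T)
  open import Data.Bool.Properties using (T-≡)
  open import Data.Fin using (Fin)
  open import Data.Vec using (Vec; []; _∷_; lookup)
  open import Data.List using (foldr; map; allFin; tabulate)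
  import Data.List.Properties as LP
  open import Data.Unit using (tt)
  open import Data.Empty using (⊥-elim)
  open import Function using (id; Equivalence)
  open import Relation.Nullary using (¬_)
  open import Relation.Binary.PropositionalEquality using (_≡_; refl; cong; trans)

  ¬T⇒≡false : ∀ {b} → ¬ T b → b ≡ false
  ¬T⇒≡false {false} _  = refl
  ¬T⇒≡false {true}  ¬t = ⊥-elim (¬t tt)

  ≤ᵇ-true : ∀ {m n} → m ≤ n → (m ≤ᵇ n) ≡ true
  ≤ᵇ-true m≤n = Equivalence.to T-≡ (ℕP.≤⇒≤ᵇ m≤n)

  ≤ᵇ-false : ∀ {m n} → ¬ m ≤ n → (m ≤ᵇ n) ≡ false
  ≤ᵇ-false {m} {n} m≰n = ¬T⇒≡false (λ t → m≰n (ℕP.≤ᵇ⇒≤ m n t))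

  <ᵇ-true : ∀ {m n} → m < n → (m <ᵇ n) ≡ true
  <ᵇ-true m<n = Equivalence.to T-≡ (ℕP.<⇒<ᵇ m<n)

  <ᵇ-false : ∀ {m n} → ¬ m < n → (m <ᵇ n) ≡ false
  <ᵇ-false {m} {n} m≮n = ¬T⇒≡false (λ t → m≮n (ℕP.<ᵇ⇒< m n t))

  ≡ᵇ-true : ∀ m → (m ≡ᵇ m) ≡ true
  ≡ᵇ-true m = Equivalence.to T-≡ (ℕP.≡⇒≡ᵇ m m refl)

  ≡ᵇ-false : ∀ {m n} → ¬ m ≡ n → (m ≡ᵇ n) ≡ false
  ≡ᵇ-false {m} {n} m≢n = ¬T⇒≡false (λ t → m≢n (ℕP.≡ᵇ⇒≡ m n t))

  <ᵇ-suc : ∀ m n → (m <ᵇ suc n) ≡ (m ≤ᵇ n)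
  <ᵇ-suc zero    n = refl
  <ᵇ-suc (suc m) n = refl

  +-≤ᵇ-∸ : ∀ m c n → (m + suc c ≤ᵇ n) ≡ (suc c ≤ᵇ n ∸ m)
  +-≤ᵇ-∸ zero    c n       = refl
  +-≤ᵇ-∸ (suc m) c zero    = refl
  +-≤ᵇ-∸ (suc m) c (suc n) = trans (<ᵇ-suc (m + suc c) n) (+-≤ᵇ-∸ m c n)

  -- Folding a vector with an index-aware function.  The definitions of P_r(n),
  -- A^𝐒 and L(𝐒) fold over `allFin r` and look entries up: the same thing.
  foldIdx : ∀ {a b} {X : Set a} {Y : Set b} {r} →
            (Y → Y → Y) → Y → (Fin r → X → Y) → Vec X r → Y
  foldIdx _⊕_ e g []       = e
  foldIdx _⊕_ e g (x ∷ xs) = g Fin.zero x ⊕ foldIdx _⊕_ e (λ i → g (Fin.suc i)) xs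

  foldr-allFin : ∀ {a b} {X : Set a} {Y : Set b} {r} (_⊕_ : Y → Y → Y) (e : Y)
                 (g : Fin r → X → Y) (S : Vec X r) →
                 foldr _⊕_ e (map (λ i → g i (lookup S i)) (allFin r)) ≡ foldIdx _⊕_ e g S
  foldr-allFin _⊕_ e g S =
    trans (cong (foldr _⊕_ e) (LP.map-tabulate id (λ i → g i (lookup S i)))) (go g S)
    where
    go : ∀ {r} (g : Fin r → _) (S : Vec _ r) →
         foldr _⊕_ e (tabulate (λ i → g i (lookup S i))) ≡ foldIdx _⊕_ e g S
    go g []       = refl
    go g (x ∷ xs) = cong (g Fin.zero x ⊕_) (go (λ i → g (Fin.suc i)) xs)

module Binomial where

  open import Data.Nat as ℕ using (ℕ; zero; suc; _≤_; _<_; z≤n; s≤s)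
  import Data.Nat.Properties as ℕP
  open import Data.Nat.Combinatorics
    using (_C_; nCk+nC[k+1]≡[n+1]C[k+1]; k>n⇒nCk≡0; nC1≡n; nCn≡1)
  open import Data.Nat.Divisibility using (_∣_; divides; ∣⇒≤)
  open import Data.Nat.Primality using (Prime; euclidsLemma)
  open import Data.Sum using (inj₁; inj₂)
  open import Data.Empty using (⊥-elim)
  open import Data.Fin using (Fin; toℕ; fromℕ; inject₁)
  import Data.Fin.Properties as FinP
  open import Algebra.Bundles using (CommutativeRing)
  open import Relation.Binary.PropositionalEquality as ≡ using (_≡_)

  absorption : ∀ n k → suc k ℕ.* (suc n C suc k) ≡ suc n ℕ.* (n C k)
  absorption zero zero = ≡.refl
  absorption zero (suc k)
    rewrite k>n⇒nCk≡0 {1} {suc (suc k)} (s≤s (s≤s z≤n)) | k>n⇒nCk≡0 {0} {suc k} (s≤s z≤n)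
    = ℕP.*-zeroʳ (suc (suc k))
  absorption (suc n) zero =
    ≡.trans (ℕP.+-identityʳ _) (≡.trans (nC1≡n (suc (suc n))) (≡.sym (ℕP.*-identityʳ _)))
  absorption (suc n) (suc k) = begin
      suc (suc k) ℕ.* (suc (suc n) C suc (suc k))
    ≡⟨ ≡.cong (suc (suc k) ℕ.*_) (≡.sym (nCk+nC[k+1]≡[n+1]C[k+1] (suc n) (suc k))) ⟩
      suc (suc k) ℕ.* (suc n C suc k ℕ.+ suc n C suc (suc k))
    ≡⟨ ℕP.*-distribˡ-+ (suc (suc k)) (suc n C suc k) _ ⟩
      (suc n C suc k ℕ.+ suc k ℕ.* (suc n C suc k)) ℕ.+ suc (suc k) ℕ.* (suc n C suc (suc k))
    ≡⟨ ≡.cong₂ (λ u v → (suc n C suc k ℕ.+ u) ℕ.+ v) (absorption n k) (absorption n (suc k)) ⟩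
      (suc n C suc k ℕ.+ suc n ℕ.* (n C k)) ℕ.+ suc n ℕ.* (n C suc k)
    ≡⟨ ℕP.+-assoc (suc n C suc k) _ _ ⟩
      suc n C suc k ℕ.+ (suc n ℕ.* (n C k) ℕ.+ suc n ℕ.* (n C suc k))
    ≡⟨ ≡.cong (suc n C suc k ℕ.+_) (≡.sym (ℕP.*-distribˡ-+ (suc n) (n C k) _)) ⟩
      suc n C suc k ℕ.+ suc n ℕ.* (n C k ℕ.+ n C suc k)
    ≡⟨ ≡.cong (λ z → suc n C suc k ℕ.+ suc n ℕ.* z) (nCk+nC[k+1]≡[n+1]C[k+1] n k) ⟩
      suc n C suc k ℕ.+ suc n ℕ.* (suc n C suc k)
    ∎
    where open ≡.≡-Reasoning

  -- A prime p divides C(p,k) for 0 < k < p: it divides k·C(p,k) = p·C(p-1,k-1)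
  -- but not k.
  prime∣binomial : ∀ p k → Prime p → 0 < k → k < p → p ∣ (p C k)
  prime∣binomial (suc n) (suc k) pp _ k<p
    with euclidsLemma (suc k) (suc n C suc k) pp
           (≡.subst (suc n ∣_) (≡.sym (absorption n k)) (divides (n C k) (ℕP.*-comm (suc n) (n C k))))
  ... | inj₂ p∣C = p∣C
  ... | inj₁ p∣k = ⊥-elim (ℕP.<⇒≱ k<p (∣⇒≤ p∣k))

  module Frobenius {c ℓ} (R : CommutativeRing c ℓ) (p : ℕ) (pp : Prime p) where
    open CommutativeRing R
    open import Algebra.Properties.Semiring.Mult semiring using (_×_; ×-congʳ; ×-congˡ; ×-assocˡ; ×-assoc-*; ×-homo-1)
    open import Algebra.Properties.Semiring.Exp semiring using (_^_; ^-congˡ; ^-assocʳ)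
    open import Algebra.Properties.Semiring.Sum semiring using (sum; sum-init-last)
    open import Algebra.Properties.CommutativeSemiring.Binomial commutativeSemiring
      using (theorem; binomialTerm)
    open import Relation.Binary.Reasoning.Setoid setoid

    module _ (char : p × 1# ≈ 0#) where

      multiple-of-p≈0 : ∀ t x → (t ℕ.* p) × x ≈ 0#
      multiple-of-p≈0 t x = begin
        (t ℕ.* p) × x    ≈⟨ sym (×-assocˡ x t p) ⟩
        t × (p × x)      ≈⟨ ×-congʳ t (×-congʳ p (sym (*-identityˡ x))) ⟩
        t × (p × (1# * x)) ≈⟨ ×-congʳ t (sym (×-assoc-* p 1# x)) ⟩
        t × ((p × 1#) * x) ≈⟨ ×-congʳ t (trans (*-congʳ char) (zeroˡ x)) ⟩
        t × 0#           ≈⟨ ×-zero t ⟩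
        0#               ∎
        where
        ×-zero : ∀ t → t × 0# ≈ 0#
        ×-zero zero    = refl
        ×-zero (suc t) = trans (+-congˡ (×-zero t)) (+-identityʳ 0#)

      -- (x + y)^p = x^p + y^p: all middle binomial terms are multiples of p.
      frobenius-additive : ∀ x y → (x + y) ^ p ≈ x ^ p + y ^ p
      frobenius-additive x y = go p pp ≡.refl
        where
        go : ∀ m → Prime m → m ≡ p → (x + y) ^ p ≈ x ^ p + y ^ p
        go (suc (suc n)) _ ≡.refl = begin
          (x + y) ^ p                                    ≈⟨ theorem p x y ⟩
          sum term                                       ≈⟨ +-congˡ (sum-init-last (λ i → term (Fin.suc i))) ⟩
          term Fin.zero + (sum middle + term (fromℕ p)) ≈⟨ +-congˡ (+-congʳ (sum≈0 middle middle≈0)) ⟩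
          term Fin.zero + (0# + term (fromℕ p))         ≈⟨ trans (+-congˡ (+-identityˡ _)) (+-comm _ _) ⟩
          term (fromℕ p) + term Fin.zero                ≈⟨ +-cong top bottom ⟩
          x ^ p + y ^ p                                  ∎
          where
          term : Fin (suc p) → Carrier
          term = binomialTerm x y p
          middle : Fin (suc n) → Carrier
          middle i = term (Fin.suc (inject₁ i))
          sum≈0 : ∀ {k} (f : Fin k → Carrier) → (∀ i → f i ≈ 0#) → sum f ≈ 0#
          sum≈0 {zero}  f f≈0 = refl
          sum≈0 {suc k} f f≈0 =
            trans (+-cong (f≈0 Fin.zero) (sum≈0 (λ i → f (Fin.suc i)) (λ i → f≈0 (Fin.suc i))))
                  (+-identityʳ 0#)
          middle≈0 : ∀ i → middle i ≈ 0#
          middle≈0 i with prime∣binomial p (suc (toℕ (inject₁ i))) pp (s≤s z≤n)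
                            (s≤s (s≤s (≡.subst (_≤ n) (≡.sym (FinP.toℕ-inject₁ i)) (ℕP.≤-pred (FinP.toℕ<n i)))))
          ... | divides t eq =
            trans (×-congˡ eq) (multiple-of-p≈0 t _)
          top : term (fromℕ p) ≈ x ^ p
          top = begin
            term (fromℕ p)
              ≈⟨ reflexive (≡.cong (λ k → (p C k) × (x ^ k * y ^ (p ℕ.∸ k))) (FinP.toℕ-fromℕ p)) ⟩
            (p C p) × (x ^ p * y ^ (p ℕ.∸ p))
              ≈⟨ reflexive (≡.cong₂ (λ c k → c × (x ^ p * y ^ k)) (nCn≡1 p) (ℕP.n∸n≡0 p)) ⟩
            1 × (x ^ p * 1#)
              ≈⟨ trans (×-homo-1 _) (*-identityʳ _) ⟩
            x ^ p ∎
          bottom : term Fin.zero ≈ y ^ p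
          bottom = trans (×-homo-1 _) (*-identityˡ _)

      frobenius-additive-iterated : ∀ k x y → (x + y) ^ (p ℕ.^ k) ≈ x ^ (p ℕ.^ k) + y ^ (p ℕ.^ k)
      frobenius-additive-iterated zero    x y = distribʳ 1# x y
      frobenius-additive-iterated (suc k) x y = begin
        (x + y) ^ (p ℕ.* p ℕ.^ k)             ≈⟨ sym (^-assocʳ (x + y) p (p ℕ.^ k)) ⟩
        ((x + y) ^ p) ^ (p ℕ.^ k)             ≈⟨ ^-congˡ (p ℕ.^ k) (frobenius-additive x y) ⟩
        (x ^ p + y ^ p) ^ (p ℕ.^ k)           ≈⟨ frobenius-additive-iterated k _ _ ⟩
        (x ^ p) ^ (p ℕ.^ k) + (y ^ p) ^ (p ℕ.^ k) ≈⟨ +-cong (^-assocʳ x p _) (^-assocʳ y p _) ⟩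
        x ^ (p ℕ.* p ℕ.^ k) + y ^ (p ℕ.^ suc k) ∎

module FieldFacts {c ℓ} (F : Field c ℓ) where
  open Prelude
  open import Level using (Level)
  open import Data.Nat as ℕ using (ℕ; zero; suc; _∸_; _≤ᵇ_; _<ᵇ_; _<_; z≤n; s≤s)
  import Data.Nat.Properties as ℕP
  open import Data.Bool using (Bool; true; false; _∧_; if_then_else_; T?)
  open import Data.Fin using (Fin)
  open import Data.List using (List; []; _∷_; _++_; map; concatMap; filter; allFin; upTo; tabulate)
  import Data.List.Properties as LP
  open import Function using (_∘_; id)
  open import Relation.Nullary using (¬_)
  open import Relation.Binary.PropositionalEquality as ≡ using (_≡_)

  open Field F public
  open RingNotions commutativeRing public
  open import Relation.Binary.Reasoning.Setoid setoid public
  open import Algebra.Properties.Semiring.Sum semiring public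
    using (sum; ∑-distrib-+; ∑-comm; *-distribˡ-sum; *-distribʳ-sum) renaming (sum-cong-≋ to sum-cong)
  open import Algebra.Properties.Semiring.Sum semiring using (sum-replicate-zero)
  open import Algebra.Properties.Semiring.Exp semiring using (_^_; ^-congˡ; ^-assocʳ; ^-homo-*)
  open import Algebra.Properties.CommutativeSemiring.Exp commutativeSemiring using (^-distrib-*)
  import Algebra.Properties.Ring ring as RingProperties
  open import Algebra.Properties.CommutativeSemigroup +-commutativeSemigroup using (interchange)

  private variable
    a : Level
    X Y : Set a

  sumOver : (X → Carrier) → List X → Carrier
  sumOver f L = sumL (map f L)

  sumOver-cong : ∀ {f g : X → Carrier} L → (∀ x → f x ≈ g x) → sumOver f L ≈ sumOver g L
  sumOver-cong []      f≈g = refl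
  sumOver-cong (x ∷ L) f≈g = +-cong (f≈g x) (sumOver-cong L f≈g)

  sumOver-zero : ∀ {f : X → Carrier} L → (∀ x → f x ≈ 0#) → sumOver f L ≈ 0#
  sumOver-zero []      f≈0 = refl
  sumOver-zero (x ∷ L) f≈0 = trans (+-cong (f≈0 x) (sumOver-zero L f≈0)) (+-identityʳ 0#)

  sumOver-++ : ∀ (f : X → Carrier) L M → sumOver f (L ++ M) ≈ sumOver f L + sumOver f M
  sumOver-++ f []      M = sym (+-identityˡ _)
  sumOver-++ f (x ∷ L) M = trans (+-congˡ (sumOver-++ f L M)) (sym (+-assoc _ _ _))

  sumOver-+ : ∀ (f g : X → Carrier) L → sumOver (λ x → f x + g x) L ≈ sumOver f L + sumOver g L
  sumOver-+ f g []      = sym (+-identityʳ 0#)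
  sumOver-+ f g (x ∷ L) = trans (+-congˡ (sumOver-+ f g L)) (interchange _ _ _ _)

  *-distribˡ-sumOver : ∀ k (f : X → Carrier) L → k * sumOver f L ≈ sumOver (λ x → k * f x) L
  *-distribˡ-sumOver k f []      = zeroʳ k
  *-distribˡ-sumOver k f (x ∷ L) = trans (distribˡ k _ _) (+-congˡ (*-distribˡ-sumOver k f L))

  *-distribʳ-sumOver : ∀ k (f : X → Carrier) L → sumOver f L * k ≈ sumOver (λ x → f x * k) L
  *-distribʳ-sumOver k f L =
    trans (*-comm _ k) (trans (*-distribˡ-sumOver k f L) (sumOver-cong L (λ x → *-comm k (f x))))

  sumOver-map : ∀ (f : Y → Carrier) (g : X → Y) L → sumOver f (map g L) ≈ sumOver (f ∘ g) L
  sumOver-map f g L = reflexive (≡.cong sumL (≡.sym (LP.map-∘ L)))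

  sumOver-concatMap : ∀ (f : Y → Carrier) (g : X → List Y) L →
                      sumOver f (concatMap g L) ≈ sumOver (λ x → sumOver f (g x)) L
  sumOver-concatMap f g []      = refl
  sumOver-concatMap f g (x ∷ L) =
    trans (sumOver-++ f (g x) (concatMap g L)) (+-congˡ (sumOver-concatMap f g L))

  sumOver-comm : ∀ (g : X → Y → Carrier) L (M : List Y) →
                 sumOver (λ x → sumOver (g x) M) L ≈ sumOver (λ y → sumOver (λ x → g x y) L) M
  sumOver-comm g []      M = sym (sumOver-zero M (λ _ → refl))
  sumOver-comm g (x ∷ L) M =
    trans (+-congˡ (sumOver-comm g L M)) (sym (sumOver-+ (g x) (λ y → sumOver (λ x → g x y) L) M))

  sumBelow-head : ∀ n f → sumBelow (suc n) f ≈ f 0 + sumBelow n (f ∘ suc)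
  sumBelow-head n f =
    +-congˡ (reflexive (≡.cong sumL (≡.trans (LP.map-applyUpTo suc f n) (≡.sym (LP.map-upTo (f ∘ suc) n)))))

  sumBelow-last : ∀ n f → sumBelow (suc n) f ≈ sumBelow n f + f n
  sumBelow-last n f = begin
    sumBelow (suc n) f               ≡⟨ ≡.cong (sumOver f) (≡.sym (LP.upTo-∷ʳ n)) ⟩
    sumOver f (upTo n ++ (n ∷ []))   ≈⟨ sumOver-++ f (upTo n) (n ∷ []) ⟩
    sumBelow n f + (f n + 0#)        ≈⟨ +-congˡ (+-identityʳ _) ⟩
    sumBelow n f + f n               ∎

  sumBelow-cong : ∀ n {f g : ℕ → Carrier} → (∀ i → i < n → f i ≈ g i) → sumBelow n f ≈ sumBelow n g
  sumBelow-cong zero    f≈g = refl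
  sumBelow-cong (suc n) {f} {g} f≈g = begin
    sumBelow (suc n) f          ≈⟨ sumBelow-head n f ⟩
    f 0 + sumBelow n (f ∘ suc)  ≈⟨ +-cong (f≈g 0 (s≤s z≤n)) (sumBelow-cong n (λ i i<n → f≈g (suc i) (s≤s i<n))) ⟩
    g 0 + sumBelow n (g ∘ suc)  ≈⟨ sym (sumBelow-head n g) ⟩
    sumBelow (suc n) g          ∎

  sumOver-allFin : ∀ {r} (f : Fin r → Carrier) → sumOver f (allFin r) ≈ sum f
  sumOver-allFin f = reflexive (≡.trans (≡.cong sumL (LP.map-tabulate id f)) (go f))
    where
    go : ∀ {r} (f : Fin r → Carrier) → sumL (tabulate f) ≡ sum f
    go {zero}  f = ≡.refl
    go {suc r} f = ≡.cong (f Fin.zero +_) (go (f ∘ Fin.suc))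

  sum-zero : ∀ {r} {f : Fin r → Carrier} → (∀ i → f i ≈ 0#) → sum f ≈ 0#
  sum-zero {r} f≈0 = trans (sum-cong f≈0) (sum-replicate-zero r)

  sumBelow-sum-comm : ∀ {r} N (h : ℕ → Fin r → Carrier) →
                      sumBelow N (λ m → sum (h m)) ≈ sum (λ i → sumBelow N (λ m → h m i))
  sumBelow-sum-comm {r} N h = begin
    sumBelow N (λ m → sum (h m))                             ≈⟨ sumOver-cong (upTo N) (λ m → sym (sumOver-allFin {r} (h m))) ⟩
    sumOver (λ m → sumOver (h m) (allFin r)) (upTo N)        ≈⟨ sumOver-comm h (upTo N) (allFin r) ⟩
    sumOver (λ i → sumBelow N (λ m → h m i)) (allFin r)      ≈⟨ sumOver-allFin {r} _ ⟩
    sum (λ i → sumBelow N (λ m → h m i))                     ∎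

  when : Bool → Carrier → Carrier
  when b x = if b then x else 0#

  when-true : ∀ {b} x → b ≡ true → when b x ≈ x
  when-true x ≡.refl = refl

  when-false : ∀ {b} x → b ≡ false → when b x ≈ 0#
  when-false x ≡.refl = refl

  when-cong : ∀ b {x y} → x ≈ y → when b x ≈ when b y
  when-cong true  x≈y = x≈y
  when-cong false x≈y = refl

  *-when : ∀ b k x → k * when b x ≈ when b (k * x)
  *-when true  k x = refl
  *-when false k x = zeroʳ k

  when-* : ∀ b k x → when b x * k ≈ when b (x * k)
  when-* true  k x = refl
  when-* false k x = zeroˡ k

  when-≡ : ∀ {b b'} x → b ≡ b' → when b x ≈ when b' x
  when-≡ x ≡.refl = refl

  when-cong-if : ∀ b {x y} → (b ≡ true → x ≈ y) → when b x ≈ when b y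
  when-cong-if true  x≈y = x≈y ≡.refl
  when-cong-if false x≈y = refl

  when-∧ : ∀ a b x → when (a ∧ b) x ≈ when a (when b x)
  when-∧ true  b x = refl
  when-∧ false b x = refl

  sumOver-when : ∀ b (f : X → Carrier) L →
                 sumOver (λ x → when b (f x)) L ≈ when b (sumOver f L)
  sumOver-when true  f L = refl
  sumOver-when false f L = sumOver-zero L (λ _ → refl)

  sumOver-filter : ∀ (P? : X → Bool) (f : X → Carrier) L →
                   sumOver f (filter (λ x → T? (P? x)) L) ≈ sumOver (λ x → when (P? x) (f x)) L
  sumOver-filter P? f []      = refl
  sumOver-filter P? f (x ∷ L) with P? x
  ... | true  = +-congˡ (sumOver-filter P? f L)
  ... | false = trans (sumOver-filter P? f L) (sym (+-identityˡ _))

  sumBelow-reindex : ∀ N c (g : ℕ → Carrier) →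
    sumBelow N (λ m → when (c ≤ᵇ m) (g (m ∸ c))) ≈ sumBelow N (λ m → when (m ℕ.+ c <ᵇ N) (g m))
  sumBelow-reindex N zero g =
    sumBelow-cong N (λ m m<N → sym (when-true _ (<ᵇ-true (≡.subst (_< N) (≡.sym (ℕP.+-identityʳ m)) m<N))))
  sumBelow-reindex zero    (suc c) g = refl
  sumBelow-reindex (suc N) (suc c) g = begin
    sumBelow (suc N) (λ m → when (suc c ≤ᵇ m) (g (m ∸ suc c)))
      ≈⟨ trans (sumBelow-head N _) (+-identityˡ _) ⟩
    sumBelow N (λ m → when (c <ᵇ suc m) (g (m ∸ c)))
      ≈⟨ sumBelow-cong N (λ m _ → when-≡ _ (<ᵇ-suc c m)) ⟩
    sumBelow N (λ m → when (c ≤ᵇ m) (g (m ∸ c)))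
      ≈⟨ sumBelow-reindex N c g ⟩
    sumBelow N (λ m → when (m ℕ.+ c <ᵇ N) (g m))
      ≈⟨ sumBelow-cong N (λ m _ → when-≡ _ (≡.cong (_<ᵇ suc N) (≡.sym (ℕP.+-suc m c)))) ⟩
    sumBelow N (λ m → when (m ℕ.+ suc c <ᵇ suc N) (g m))
      ≈⟨ sym (trans (+-congˡ (when-false _ (<ᵇ-false N+c+1≮N+1))) (+-identityʳ _)) ⟩
    sumBelow N (λ m → when (m ℕ.+ suc c <ᵇ suc N) (g m)) + when (N ℕ.+ suc c <ᵇ suc N) (g N)
      ≈⟨ sym (sumBelow-last N _) ⟩
    sumBelow (suc N) (λ m → when (m ℕ.+ suc c <ᵇ suc N) (g m)) ∎
    where
    N+c+1≮N+1 : ¬ (N ℕ.+ suc c < suc N)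
    N+c+1≮N+1 lt = ℕP.<-irrefl ≡.refl
      (ℕP.≤-trans (s≤s (ℕP.m≤m+n N c)) (ℕP.≤-trans (ℕP.≤-reflexive (≡.sym (ℕP.+-suc N c))) (ℕP.≤-pred lt)))

  cancel-nonzero : ∀ {x y} → ¬ y ≈ 0# → x * y ≈ 0# → x ≈ 0#
  cancel-nonzero {x} {y} y≉0 xy≈0 = begin
    x                  ≈⟨ sym (*-identityʳ x) ⟩
    x * 1#             ≈⟨ *-congˡ (sym (⁻¹-inverse y y≉0)) ⟩
    x * (y * y ⁻¹)     ≈⟨ sym (*-assoc x y _) ⟩
    (x * y) * y ⁻¹     ≈⟨ *-congʳ xy≈0 ⟩
    0# * y ⁻¹          ≈⟨ zeroˡ _ ⟩
    0#                 ∎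

  nonzero-* : ∀ {x y} → ¬ x ≈ 0# → ¬ y ≈ 0# → ¬ (x * y) ≈ 0#
  nonzero-* x≉0 y≉0 xy≈0 = x≉0 (cancel-nonzero y≉0 xy≈0)

  nonzero-neg : ∀ {x} → ¬ x ≈ 0# → ¬ (- x) ≈ 0#
  nonzero-neg {x} x≉0 -x≈0 =
    x≉0 (trans (sym (RingProperties.-‿involutive x)) (trans (-‿cong -x≈0) RingProperties.-0#≈0#))

  ⁻¹-unique : ∀ {x z} → ¬ x ≈ 0# → x * z ≈ 1# → x ⁻¹ ≈ z
  ⁻¹-unique {x} {z} x≉0 xz≈1 = begin
    x ⁻¹               ≈⟨ sym (*-identityʳ _) ⟩
    x ⁻¹ * 1#          ≈⟨ *-congˡ (sym xz≈1) ⟩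
    x ⁻¹ * (x * z)     ≈⟨ sym (*-assoc _ _ _) ⟩
    (x ⁻¹ * x) * z     ≈⟨ *-congʳ (trans (*-comm _ _) (⁻¹-inverse x x≉0)) ⟩
    1# * z             ≈⟨ *-identityˡ z ⟩
    z                  ∎

  ⁻¹-cong : ∀ {x y} → ¬ x ≈ 0# → x ≈ y → x ⁻¹ ≈ y ⁻¹
  ⁻¹-cong x≉0 x≈y =
    ⁻¹-unique x≉0 (trans (*-congʳ x≈y) (⁻¹-inverse _ (λ y≈0 → x≉0 (trans x≈y y≈0))))

  ⁻¹-distrib-* : ∀ {x y} → ¬ x ≈ 0# → ¬ y ≈ 0# → (x * y) ⁻¹ ≈ x ⁻¹ * y ⁻¹
  ⁻¹-distrib-* {x} {y} x≉0 y≉0 = ⁻¹-unique (nonzero-* x≉0 y≉0) (begin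
    (x * y) * (x ⁻¹ * y ⁻¹)  ≈⟨ interchange-* x y _ _ ⟩
    (x * x ⁻¹) * (y * y ⁻¹)  ≈⟨ *-cong (⁻¹-inverse x x≉0) (⁻¹-inverse y y≉0) ⟩
    1# * 1#                  ≈⟨ *-identityˡ 1# ⟩
    1#                       ∎)
    where
    open import Algebra.Properties.CommutativeSemigroup *-commutativeSemigroup
      using () renaming (interchange to interchange-*)

  1⁻¹≈1 : 1# ⁻¹ ≈ 1#
  1⁻¹≈1 = ⁻¹-unique 1≉0 (*-identityˡ 1#)

  div-mul-cancel : ∀ {x y} → ¬ y ≈ 0# → (x * y ⁻¹) * y ≈ x
  div-mul-cancel {x} {y} y≉0 =
    trans (*-assoc x _ _) (trans (*-congˡ (trans (*-comm _ _) (⁻¹-inverse y y≉0))) (*-identityʳ x))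

  pow≈^ : ∀ x n → pow x n ≈ x ^ n
  pow≈^ x zero    = refl
  pow≈^ x (suc n) = *-congˡ (pow≈^ x n)

  pow-cong : ∀ {x y} n → x ≈ y → pow x n ≈ pow y n
  pow-cong n x≈y = trans (pow≈^ _ n) (trans (^-congˡ n x≈y) (sym (pow≈^ _ n)))

  pow-≡ : ∀ x {m n} → m ≡ n → pow x m ≈ pow x n
  pow-≡ x ≡.refl = refl

  pow-+ : ∀ x m n → pow x (m ℕ.+ n) ≈ pow x m * pow x n
  pow-+ x m n = trans (pow≈^ x (m ℕ.+ n)) (trans (^-homo-* x m n) (sym (*-cong (pow≈^ x m) (pow≈^ x n))))

  pow-pow : ∀ x m n → pow (pow x m) n ≈ pow x (m ℕ.* n)
  pow-pow x m n =
    trans (pow-cong n (pow≈^ x m)) (trans (pow≈^ _ n) (trans (^-assocʳ x m n) (sym (pow≈^ x (m ℕ.* n)))))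

  pow-* : ∀ x y n → pow (x * y) n ≈ pow x n * pow y n
  pow-* x y n = trans (pow≈^ _ n) (trans (^-distrib-* x y n) (sym (*-cong (pow≈^ x n) (pow≈^ y n))))

  pow-1# : ∀ n → pow 1# n ≈ 1#
  pow-1# zero    = refl
  pow-1# (suc n) = trans (*-identityˡ _) (pow-1# n)

-- Combinatorics of the tuples (S_1,…,S_r): peeling off the membership column
-- of the element 0.  A tuple of subsets of {0,…,m} is `addColumn h t`, where
-- h records which S_i contain 0 and t is the tuple of the remaining subsets
-- shifted down by one.  To recurse, P_r(n) is generalised to the tuples that
-- `Fit` a profile p, where p k counts covers of k by blocks already removed.
module Partitions where
  open Prelude
  open import Data.Nat as ℕ using (ℕ; zero; suc; _∸_; _≤ᵇ_; _<ᵇ_; _≡ᵇ_; _+_)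
  import Data.Nat.Properties as ℕP
  open import Data.Nat.ListAction using (sum)
  import Data.Nat.ListAction.Properties as ListSum
  open import Data.Bool using (Bool; true; false; _∧_; if_then_else_)
  import Data.Bool.Properties as BoolP
  open import Data.Fin using (Fin; toℕ)
  open import Data.Vec using (Vec; []; _∷_)
  open import Data.List using ([]; _∷_; map; upTo; applyUpTo)
  import Data.List.Properties as LP
  open import Algebra.Bundles using (CommutativeMonoid)
  open import Algebra.Properties.CommutativeSemigroup ℕP.+-commutativeSemigroup
    using () renaming (interchange to +-interchange)
  open import Algebra.Properties.CommutativeSemigroup
    (CommutativeMonoid.commutativeSemigroup BoolP.∧-commutativeMonoid)
    using () renaming (interchange to ∧-interchange)
  open import Function using (_∘_)
  open import Relation.Binary.PropositionalEquality using (_≡_; refl; cong; cong₂; sym; trans; module ≡-Reasoning)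
  open import Relation.Binary.Definitions using (tri<; tri≈; tri>)

  addColumn : ∀ {r m} → Vec Bool r → Vec (Vec Bool m) r → Vec (Vec Bool (suc m)) r
  addColumn [] [] = []
  addColumn (b ∷ h) (S ∷ t) = (b ∷ S) ∷ addColumn h t

  Fits : ∀ {r n} → (ℕ → ℕ) → Vec (Vec Bool n) r → Bool
  Fits {r} {n} p 𝐒 = inRange 𝐒 ∧ boolAll (map (λ k → (countCover 𝐒 k + p k) ≡ᵇ 1) (upTo n))

  prefix : ℕ → ℕ → ℕ
  prefix d k = if k <ᵇ d then 1 else 0

  𝟙 : Bool → ℕ
  𝟙 b = if b then 1 else 0

  shiftCount : ∀ {n} → ℕ → Vec Bool n → ℕ → ℕ
  shiftCount d S k = sum (map (λ j → 𝟙 ((j ≤ᵇ k) ∧ mem S (k ∸ j))) (upTo d))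

  countCover-foldIdx : ∀ {r n} (𝐒 : Vec (Vec Bool n) r) k →
                       countCover 𝐒 k ≡ foldIdx _+_ 0 (λ i S → shiftCount (suc (toℕ i)) S k) 𝐒
  countCover-foldIdx 𝐒 k = foldr-allFin _+_ 0 (λ i S → shiftCount (suc (toℕ i)) S k) 𝐒

  map-upTo-suc : ∀ {a} {X : Set a} (f : ℕ → X) n → map f (upTo (suc n)) ≡ f 0 ∷ map (f ∘ suc) (upTo n)
  map-upTo-suc f n = cong (f 0 ∷_) (trans (LP.map-applyUpTo suc f n) (sym (LP.map-upTo (f ∘ suc) n)))

  sum-zeros : ∀ d → sum (applyUpTo (λ _ → 0) d) ≡ 0
  sum-zeros zero = refl
  sum-zeros (suc d) = sum-zeros d

  -- Only the shift j = 0 moves an element onto 0; it does so iff 0 ∈ b ∷ S.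
  shiftCount-head : ∀ {n} d b (S : Vec Bool n) → shiftCount (suc d) (b ∷ S) 0 ≡ 𝟙 b
  shiftCount-head d b S = trans (cong (λ L → sum L) (map-upTo-suc _ d))
    (trans (cong (𝟙 b +_) (trans (cong sum (LP.map-upTo _ d)) (sum-zeros d))) (ℕP.+-identityʳ _))

  shiftCount-snoc : ∀ {n} d (S : Vec Bool n) k →
                    shiftCount (suc d) S k ≡ shiftCount d S k + 𝟙 ((d ≤ᵇ k) ∧ mem S (k ∸ d))
  shiftCount-snoc d S k = trans (cong (λ L → sum (map _ L)) (sym (LP.upTo-∷ʳ d)))
    (trans (cong sum (LP.map-++ _ (upTo d) (d ∷ [])))
    (trans (ListSum.sum-++ (map _ (upTo d)) _) (cong (shiftCount d S k +_) (ℕP.+-identityʳ _))))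

  -- Counting covers of k+1 by shifts of b ∷ S: the shift j = k+1 is the one
  -- moving the element 0 onto k+1, the others are the covers of k by shifts of S.
  shiftCount-suc : ∀ {n} d b (S : Vec Bool n) k →
                   shiftCount d (b ∷ S) (suc k) ≡ shiftCount d S k + 𝟙 (b ∧ (suc k <ᵇ d))
  shiftCount-suc zero false S k = refl
  shiftCount-suc zero true S k = refl
  shiftCount-suc (suc d) b S k = begin
      shiftCount (suc d) (b ∷ S) (suc k)
    ≡⟨ shiftCount-snoc d (b ∷ S) (suc k) ⟩
      shiftCount d (b ∷ S) (suc k) + X
    ≡⟨ cong (_+ X) (shiftCount-suc d b S k) ⟩
      (shiftCount d S k + 𝟙 (b ∧ (suc k <ᵇ d))) + X
    ≡⟨ ℕP.+-assoc (shiftCount d S k) _ X ⟩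
      shiftCount d S k + (𝟙 (b ∧ (suc k <ᵇ d)) + X)
    ≡⟨ cong (shiftCount d S k +_) key ⟩
      shiftCount d S k + (Y + 𝟙 (b ∧ (suc k <ᵇ suc d)))
    ≡⟨ sym (ℕP.+-assoc (shiftCount d S k) Y _) ⟩
      (shiftCount d S k + Y) + 𝟙 (b ∧ (suc k <ᵇ suc d))
    ≡⟨ cong (_+ 𝟙 (b ∧ (suc k <ᵇ suc d))) (sym (shiftCount-snoc d S k)) ⟩
      shiftCount (suc d) S k + 𝟙 (b ∧ (suc k <ᵇ suc d))
    ∎
    where
    open ≡-Reasoning
    X = 𝟙 ((d ≤ᵇ suc k) ∧ mem (b ∷ S) (suc k ∸ d))
    Y = 𝟙 ((d ≤ᵇ k) ∧ mem S (k ∸ d))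
    key : 𝟙 (b ∧ (suc k <ᵇ d)) + X ≡ Y + 𝟙 (b ∧ (suc k <ᵇ suc d))
    key with ℕP.<-cmp d (suc k)
    ... | tri< d<sk _ _
      rewrite <ᵇ-false {suc k} {d} (ℕP.<⇒≯ d<sk)
            | <ᵇ-false {suc k} {suc d} (λ x → ℕP.≤⇒≯ (ℕP.≤-pred d<sk) (ℕP.≤-pred x))
            | ≤ᵇ-true {d} {suc k} (ℕP.<⇒≤ d<sk) | ≤ᵇ-true {d} {k} (ℕP.≤-pred d<sk)
            | ℕP.+-∸-assoc 1 (ℕP.≤-pred d<sk) | BoolP.∧-zeroʳ b = sym (ℕP.+-identityʳ _)
    ... | tri≈ _ refl _ = helper b (<ᵇ-false {k} {k} (ℕP.n≮n k)) (<ᵇ-true {k} {suc k} (ℕP.n<1+n k))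
            (cong (mem (b ∷ S)) (ℕP.n∸n≡0 k)) (≤ᵇ-false {suc k} {k} (ℕP.n≮n k))
      where
      helper : ∀ b {b1 b2 m b3 y} → b1 ≡ false → b2 ≡ true → m ≡ b → b3 ≡ false →
               𝟙 (b ∧ b1) + 𝟙 (b2 ∧ m) ≡ 𝟙 (b3 ∧ y) + 𝟙 (b ∧ b2)
      helper true refl refl refl refl = refl
      helper false refl refl refl refl = refl
    ... | tri> _ _ sk<d
      rewrite <ᵇ-true {suc k} {d} sk<d | <ᵇ-true {suc k} {suc d} (ℕP.m<n⇒m<1+n sk<d)
            | ≤ᵇ-false {d} {suc k} (ℕP.<⇒≱ sk<d)
            | ≤ᵇ-false {d} {k} (λ x → ℕP.<⇒≱ sk<d (ℕP.m≤n⇒m≤1+n x)) = ℕP.+-comm _ 0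

  -- The cover counts of addColumn h t, with block lengths D i + 1 (the length
  -- is a parameter so that the recursion on the tuple can shift the index).
  columnCount-zero : ∀ {r m} (D : Fin r → ℕ) (h : Vec Bool r) (t : Vec (Vec Bool m) r) →
    foldIdx _+_ 0 (λ i S → shiftCount (suc (D i)) S 0) (addColumn h t) ≡ foldIdx _+_ 0 (λ _ b → 𝟙 b) h
  columnCount-zero D []      []      = refl
  columnCount-zero D (b ∷ h) (S ∷ t) =
    cong₂ _+_ (shiftCount-head (D Fin.zero) b S) (columnCount-zero (λ i → D (Fin.suc i)) h t)

  columnCount-suc : ∀ {r m} (D : Fin r → ℕ) (h : Vec Bool r) (t : Vec (Vec Bool m) r) k →
    foldIdx _+_ 0 (λ i S → shiftCount (suc (D i)) S (suc k)) (addColumn h t)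
    ≡ foldIdx _+_ 0 (λ i S → shiftCount (suc (D i)) S k) t + foldIdx _+_ 0 (λ i b → 𝟙 (b ∧ (suc k <ᵇ suc (D i)))) h
  columnCount-suc D []      []      k = refl
  columnCount-suc D (b ∷ h) (S ∷ t) k =
    trans (cong₂ _+_ (shiftCount-suc (suc (D Fin.zero)) b S k) (columnCount-suc (λ i → D (Fin.suc i)) h t k))
          (+-interchange (shiftCount (suc (D Fin.zero)) S k) (𝟙 (b ∧ (suc k <ᵇ suc (D Fin.zero))))
                         (foldIdx _+_ 0 (λ i S → shiftCount (suc (D (Fin.suc i))) S k) t)
                         (foldIdx _+_ 0 (λ i b → 𝟙 (b ∧ (suc k <ᵇ suc (D (Fin.suc i))))) h))

  ones : ∀ {r} → Vec Bool r → ℕ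
  ones h = foldIdx _+_ 0 (λ _ b → 𝟙 b) h

  -- The number of blocks S_i + 0 (i ∈ h) that also contain k + 1.
  overhang : ∀ {r} → Vec Bool r → ℕ → ℕ
  overhang h k = foldIdx _+_ 0 (λ i b → 𝟙 (b ∧ (suc k <ᵇ suc (toℕ i)))) h

  columnInRange : ∀ {r} → ℕ → Vec Bool r → Bool
  columnInRange m h = foldIdx _∧_ true (λ i b → if b then suc (toℕ i) ≤ᵇ suc m else true) h

  countCover-addColumn-zero : ∀ {r m} (h : Vec Bool r) (t : Vec (Vec Bool m) r) →
                              countCover (addColumn h t) 0 ≡ ones h
  countCover-addColumn-zero h t = trans (countCover-foldIdx (addColumn h t) 0) (columnCount-zero toℕ h t)

  countCover-addColumn-suc : ∀ {r m} (h : Vec Bool r) (t : Vec (Vec Bool m) r) k →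
                             countCover (addColumn h t) (suc k) ≡ countCover t k + overhang h k
  countCover-addColumn-suc h t k =
    trans (countCover-foldIdx (addColumn h t) (suc k))
          (trans (columnCount-suc toℕ h t k) (cong (_+ overhang h k) (sym (countCover-foldIdx t k))))

  blocksInRange : ∀ {k} → ℕ → ℕ → Vec Bool k → Bool
  blocksInRange n D S = boolAll (map (λ s → s + suc D ≤ᵇ n) (elems S))

  blocksInRange-cons : ∀ {k} D m b (S : Vec Bool k) →
    blocksInRange (suc m) D (b ∷ S) ≡ (if b then suc D ≤ᵇ suc m else true) ∧ blocksInRange m D S
  blocksInRange-cons D m true  S =
    cong (λ z → (suc D ≤ᵇ suc m) ∧ boolAll z) (trans (sym (LP.map-∘ (elems S))) (LP.map-cong (λ s → <ᵇ-suc (s + suc D) m) (elems S)))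
  blocksInRange-cons D m false S =
    cong boolAll (trans (sym (LP.map-∘ (elems S))) (LP.map-cong (λ s → <ᵇ-suc (s + suc D) m) (elems S)))

  inRange-fold-addColumn : ∀ {r m} (D : Fin r → ℕ) (h : Vec Bool r) (t : Vec (Vec Bool m) r) →
    foldIdx _∧_ true (λ i → blocksInRange (suc m) (D i)) (addColumn h t)
    ≡ foldIdx _∧_ true (λ i b → if b then suc (D i) ≤ᵇ suc m else true) h ∧ foldIdx _∧_ true (λ i → blocksInRange m (D i)) t
  inRange-fold-addColumn D []      []      = refl
  inRange-fold-addColumn {m = m} D (b ∷ h) (S ∷ t) =
    trans (cong₂ _∧_ (blocksInRange-cons (D Fin.zero) m b S) (inRange-fold-addColumn (λ i → D (Fin.suc i)) h t))
          (∧-interchange (if b then suc (D Fin.zero) ≤ᵇ suc m else true) (blocksInRange m (D Fin.zero) S)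
                         (foldIdx _∧_ true (λ i b → if b then suc (D (Fin.suc i)) ≤ᵇ suc m else true) h)
                         (foldIdx _∧_ true (λ i → blocksInRange m (D (Fin.suc i))) t))

  inRange-foldIdx : ∀ {r n} (𝐒 : Vec (Vec Bool n) r) → inRange 𝐒 ≡ foldIdx _∧_ true (λ i → blocksInRange n (toℕ i)) 𝐒
  inRange-foldIdx {n = n} 𝐒 = foldr-allFin _∧_ true (λ i → blocksInRange n (toℕ i)) 𝐒

  inRange-addColumn : ∀ {r m} (h : Vec Bool r) (t : Vec (Vec Bool m) r) →
                      inRange (addColumn h t) ≡ columnInRange m h ∧ inRange t
  inRange-addColumn h t =
    trans (inRange-foldIdx (addColumn h t))
          (trans (inRange-fold-addColumn toℕ h t) (cong (columnInRange _ h ∧_) (sym (inRange-foldIdx t))))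

  Fits-cong : ∀ {r n} {p p' : ℕ → ℕ} (𝐒 : Vec (Vec Bool n) r) → (∀ k → p k ≡ p' k) → Fits p 𝐒 ≡ Fits p' 𝐒
  Fits-cong {n = n} 𝐒 p≗p' =
    cong (λ z → inRange 𝐒 ∧ boolAll z) (LP.map-cong (λ k → cong (λ z → (countCover 𝐒 k + z) ≡ᵇ 1) (p≗p' k)) (upTo n))

  Fits-addColumn : ∀ {r m} (p : ℕ → ℕ) (h : Vec Bool r) (t : Vec (Vec Bool m) r) →
    Fits p (addColumn h t) ≡ (columnInRange m h ∧ ((ones h + p 0) ≡ᵇ 1)) ∧ Fits (λ k → p (suc k) + overhang h k) t
  Fits-addColumn {m = m} p h t = begin
      Fits p (addColumn h t)
    ≡⟨ cong₂ _∧_ (inRange-addColumn h t) (cong boolAll (map-upTo-suc _ m)) ⟩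
      (columnInRange m h ∧ inRange t) ∧ (((countCover (addColumn h t) 0 + p 0) ≡ᵇ 1) ∧ covered (addColumn h t))
    ≡⟨ cong₂ (λ x y → (columnInRange m h ∧ inRange t) ∧ (((x + p 0) ≡ᵇ 1) ∧ boolAll y))
             (countCover-addColumn-zero h t) (LP.map-cong (λ k → cong (_≡ᵇ 1) (count k)) (upTo m)) ⟩
      (columnInRange m h ∧ inRange t) ∧ (((ones h + p 0) ≡ᵇ 1) ∧ coveredTail)
    ≡⟨ ∧-interchange (columnInRange m h) (inRange t) ((ones h + p 0) ≡ᵇ 1) coveredTail ⟩
      (columnInRange m h ∧ ((ones h + p 0) ≡ᵇ 1)) ∧ Fits (λ k → p (suc k) + overhang h k) t
    ∎
    where
    open ≡-Reasoning
    covered : Vec (Vec Bool (suc m)) _ → Bool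
    covered 𝐒 = boolAll (map (λ k → (countCover 𝐒 (suc k) + p (suc k)) ≡ᵇ 1) (upTo m))
    coveredTail = boolAll (map (λ k → (countCover t k + (p (suc k) + overhang h k)) ≡ᵇ 1) (upTo m))
    count : ∀ k → countCover (addColumn h t) (suc k) + p (suc k) ≡ countCover t k + (p (suc k) + overhang h k)
    count k = trans (cong (_+ p (suc k)) (countCover-addColumn-suc h t k))
                    (trans (ℕP.+-assoc (countCover t k) (overhang h k) (p (suc k)))
                           (cong (countCover t k +_) (ℕP.+-comm (overhang h k) (p (suc k)))))

  zeros : ∀ {r} → Vec Bool r
  zeros {zero}  = []
  zeros {suc r} = false ∷ zeros

  unit : ∀ {r} → Fin r → Vec Bool r
  unit Fin.zero    = true ∷ zeros
  unit (Fin.suc i) = false ∷ unit i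

  module _ {A : Set} (_⊕_ : A → A → A) (e : A) (identityˡ : ∀ x → e ⊕ x ≡ x) (identityʳ : ∀ x → x ⊕ e ≡ x) where

    foldIdx-zeros : ∀ {r} (g : Fin r → Bool → A) → (∀ i → g i false ≡ e) → foldIdx _⊕_ e g zeros ≡ e
    foldIdx-zeros {zero}  g g≡e = refl
    foldIdx-zeros {suc r} g g≡e =
      trans (cong (_⊕ foldIdx _⊕_ e (g ∘ Fin.suc) zeros) (g≡e Fin.zero))
            (trans (identityˡ _) (foldIdx-zeros (g ∘ Fin.suc) (g≡e ∘ Fin.suc)))

    foldIdx-unit : ∀ {r} (g : Fin r → Bool → A) → (∀ i → g i false ≡ e) → ∀ i → foldIdx _⊕_ e g (unit i) ≡ g i true
    foldIdx-unit g g≡e Fin.zero =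
      trans (cong (g Fin.zero true ⊕_) (foldIdx-zeros (g ∘ Fin.suc) (g≡e ∘ Fin.suc))) (identityʳ _)
    foldIdx-unit g g≡e (Fin.suc i) =
      trans (cong (_⊕ foldIdx _⊕_ e (g ∘ Fin.suc) (unit i)) (g≡e Fin.zero))
            (trans (identityˡ _) (foldIdx-unit (g ∘ Fin.suc) (g≡e ∘ Fin.suc) i))

  ones-zeros : ∀ {r} → ones (zeros {r}) ≡ 0
  ones-zeros {r} = foldIdx-zeros _+_ 0 ℕP.+-identityˡ ℕP.+-identityʳ {r} (λ _ b → 𝟙 b) (λ _ → refl)

  overhang-zeros : ∀ {r} k → overhang (zeros {r}) k ≡ 0
  overhang-zeros {r} k = foldIdx-zeros _+_ 0 ℕP.+-identityˡ ℕP.+-identityʳ {r}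
                                   (λ j b → 𝟙 (b ∧ (suc k <ᵇ suc (toℕ j)))) (λ _ → refl)

  columnInRange-zeros : ∀ {r} m → columnInRange m (zeros {r}) ≡ true
  columnInRange-zeros {r} m = foldIdx-zeros _∧_ true BoolP.∧-identityˡ BoolP.∧-identityʳ {r}
                                        (λ j b → if b then suc (toℕ j) ≤ᵇ suc m else true) (λ _ → refl)

  ones-unit : ∀ {r} (i : Fin r) → ones (unit i) ≡ 1
  ones-unit = foldIdx-unit _+_ 0 ℕP.+-identityˡ ℕP.+-identityʳ (λ _ b → 𝟙 b) (λ _ → refl)

  overhang-unit : ∀ {r} (i : Fin r) k → overhang (unit i) k ≡ prefix (toℕ i) k
  overhang-unit i k = foldIdx-unit _+_ 0 ℕP.+-identityˡ ℕP.+-identityʳ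
                                    (λ j b → 𝟙 (b ∧ (suc k <ᵇ suc (toℕ j)))) (λ _ → refl) i

  columnInRange-unit : ∀ {r} m (i : Fin r) → columnInRange m (unit i) ≡ (suc (toℕ i) ≤ᵇ suc m)
  columnInRange-unit m = foldIdx-unit _∧_ true BoolP.∧-identityˡ BoolP.∧-identityʳ
                                      (λ j b → if b then suc (toℕ j) ≤ᵇ suc m else true) (λ _ → refl)

  emptyTuple : ∀ {r} → Vec (Vec Bool 0) r
  emptyTuple {zero}  = []
  emptyTuple {suc r} = [] ∷ emptyTuple

  Fits-empty : ∀ {r} (p : ℕ → ℕ) → Fits p (emptyTuple {r}) ≡ true
  Fits-empty {r} p = cong (_∧ true) (trans (inRange-foldIdx (emptyTuple {r})) (go {r} toℕ))
    where
    go : ∀ {r} (D : Fin r → ℕ) → foldIdx _∧_ true (λ i → blocksInRange 0 (D i)) emptyTuple ≡ true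
    go {zero}  D = refl
    go {suc r} D = go (λ i → D (Fin.suc i))

  isInP≡Fits : ∀ {r n} (𝐒 : Vec (Vec Bool n) r) → isInP 𝐒 ≡ Fits (prefix 0) 𝐒
  isInP≡Fits {n = n} 𝐒 = cong (λ z → inRange 𝐒 ∧ boolAll z)
    (LP.map-cong (λ k → cong (_≡ᵇ 1) (sym (ℕP.+-identityʳ (countCover 𝐒 k)))) (upTo n))

module TupleSums {c ℓ} (F : Field c ℓ) where
  open Prelude
  open Partitions
  open import Data.Nat as ℕ using (ℕ; zero; suc; _≤_; z≤n; s≤s)
  open import Data.Bool using (Bool; true; false; if_then_else_)
  open import Data.Fin using (Fin)
  open import Data.Vec using (Vec; []; _∷_)
  open import Data.List using (map)
  open import Function using (_∘_)
  open import Relation.Nullary using (¬_)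

  open FieldFacts F

  sumOver-allSubsets-suc : ∀ n (f : Vec Bool (suc n) → Carrier) →
    sumOver f (allSubsets (suc n)) ≈ sumOver (f ∘ (true ∷_)) (allSubsets n) + sumOver (f ∘ (false ∷_)) (allSubsets n)
  sumOver-allSubsets-suc n f =
    trans (sumOver-++ f (map (true ∷_) (allSubsets n)) _)
          (+-cong (sumOver-map f (true ∷_) (allSubsets n)) (sumOver-map f (false ∷_) (allSubsets n)))

  sumOver-allTuples-cons : ∀ r n (g : Vec (Vec Bool n) (suc r) → Carrier) →
    sumOver g (allTuples (suc r) n) ≈ sumOver (λ S → sumOver (g ∘ (S ∷_)) (allTuples r n)) (allSubsets n)
  sumOver-allTuples-cons r n g =
    trans (sumOver-concatMap g _ (allSubsets n)) (sumOver-cong (allSubsets n) (λ S → sumOver-map g (S ∷_) (allTuples r n)))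

  sumOver-allTuples-zero : ∀ r (g : Vec (Vec Bool 0) r → Carrier) → sumOver g (allTuples r 0) ≈ g emptyTuple
  sumOver-allTuples-zero zero    g = +-identityʳ _
  sumOver-allTuples-zero (suc r) g =
    trans (sumOver-allTuples-cons r 0 g) (trans (+-identityʳ _) (sumOver-allTuples-zero r (g ∘ ([] ∷_))))

  sumOver-allTuples-addColumn : ∀ r m (g : Vec (Vec Bool (suc m)) r → Carrier) →
    sumOver g (allTuples r (suc m)) ≈ sumOver (λ h → sumOver (g ∘ addColumn h) (allTuples r m)) (allSubsets r)
  sumOver-allTuples-addColumn zero    m g = sym (+-identityʳ _)
  sumOver-allTuples-addColumn (suc r) m g = begin
      sumOver g (allTuples (suc r) (suc m))
    ≈⟨ sumOver-allTuples-cons r (suc m) g ⟩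
      sumOver (λ S → sumOver (g ∘ (S ∷_)) (allTuples r (suc m))) (allSubsets (suc m))
    ≈⟨ sumOver-allSubsets-suc m _ ⟩
      firstRowFixed true + firstRowFixed false
    ≈⟨ +-cong (byColumn true) (byColumn false) ⟩
      sumOver (λ h → sumOver (g ∘ addColumn (true ∷ h)) (allTuples (suc r) m)) (allSubsets r)
      + sumOver (λ h → sumOver (g ∘ addColumn (false ∷ h)) (allTuples (suc r) m)) (allSubsets r)
    ≈⟨ sym (sumOver-allSubsets-suc r _) ⟩
      sumOver (λ h → sumOver (g ∘ addColumn h) (allTuples (suc r) m)) (allSubsets (suc r))
    ∎
    where
    firstRowFixed : Bool → Carrier
    firstRowFixed b = sumOver (λ S → sumOver (λ t → g ((b ∷ S) ∷ t)) (allTuples r (suc m))) (allSubsets m)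
    byColumn : ∀ b → firstRowFixed b
                     ≈ sumOver (λ h → sumOver (g ∘ addColumn (b ∷ h)) (allTuples (suc r) m)) (allSubsets r)
    byColumn b = begin
        firstRowFixed b
      ≈⟨ sumOver-cong (allSubsets m) (λ S → sumOver-allTuples-addColumn r m (λ t → g ((b ∷ S) ∷ t))) ⟩
        sumOver (λ S → sumOver (λ h → sumOver (λ t → g ((b ∷ S) ∷ addColumn h t)) (allTuples r m)) (allSubsets r))
                (allSubsets m)
      ≈⟨ sumOver-comm (λ S h → sumOver (λ t → g ((b ∷ S) ∷ addColumn h t)) (allTuples r m)) (allSubsets m) (allSubsets r) ⟩
        sumOver (λ h → sumOver (λ S → sumOver (λ t → g ((b ∷ S) ∷ addColumn h t)) (allTuples r m)) (allSubsets m))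
                (allSubsets r)
      ≈⟨ sumOver-cong (allSubsets r) (λ h → sym (sumOver-allTuples-cons r m (g ∘ addColumn (b ∷ h)))) ⟩
        sumOver (λ h → sumOver (g ∘ addColumn (b ∷ h)) (allTuples (suc r) m)) (allSubsets r)
      ∎

  sumOver-columns-noOnes : ∀ r (X : Vec Bool r → Carrier) → (∀ h → 1 ≤ ones h → X h ≈ 0#) →
                           sumOver X (allSubsets r) ≈ X zeros
  sumOver-columns-noOnes zero    X X≈0 = +-identityʳ _
  sumOver-columns-noOnes (suc r) X X≈0 = begin
    sumOver X (allSubsets (suc r))
      ≈⟨ sumOver-allSubsets-suc r X ⟩
    sumOver (X ∘ (true ∷_)) (allSubsets r) + sumOver (X ∘ (false ∷_)) (allSubsets r)
      ≈⟨ +-cong (sumOver-zero (allSubsets r) (λ h → X≈0 (true ∷ h) (s≤s z≤n)))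
                (sumOver-columns-noOnes r (X ∘ (false ∷_)) (X≈0 ∘ (false ∷_))) ⟩
    0# + X zeros
      ≈⟨ +-identityˡ _ ⟩
    X zeros ∎

  sumOver-columns-atMostOne : ∀ r (X : Vec Bool r → Carrier) → (∀ h → 2 ≤ ones h → X h ≈ 0#) →
                              sumOver X (allSubsets r) ≈ X zeros + sum (X ∘ unit)
  sumOver-columns-atMostOne zero    X X≈0 = refl
  sumOver-columns-atMostOne (suc r) X X≈0 = begin
    sumOver X (allSubsets (suc r))
      ≈⟨ sumOver-allSubsets-suc r X ⟩
    sumOver (X ∘ (true ∷_)) (allSubsets r) + sumOver (X ∘ (false ∷_)) (allSubsets r)
      ≈⟨ +-cong (sumOver-columns-noOnes r (X ∘ (true ∷_)) (λ h 1≤ → X≈0 (true ∷ h) (s≤s 1≤)))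
                (sumOver-columns-atMostOne r (X ∘ (false ∷_)) (X≈0 ∘ (false ∷_))) ⟩
    X (true ∷ zeros) + (X (false ∷ zeros) + sum (λ i → X (false ∷ unit i)))
      ≈⟨ trans (sym (+-assoc _ _ _)) (trans (+-congʳ (+-comm _ _)) (+-assoc _ _ _)) ⟩
    X zeros + sum (X ∘ unit) ∎

  rowProduct : ∀ {n} → (ℕ → Carrier) → Vec Bool n → Carrier
  rowProduct g []       = 1#
  rowProduct g (b ∷ bs) = (if b then g 0 else 1#) * rowProduct (g ∘ suc) bs

  tupleProduct : ∀ {r n} → (Fin r → ℕ → Carrier) → Vec (Vec Bool n) r → Carrier
  tupleProduct G 𝐒 = foldIdx _*_ 1# (λ i S → rowProduct (G i) S) 𝐒

  shift : ∀ {r} → ℕ → (Fin r → ℕ → Carrier) → (Fin r → ℕ → Carrier)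
  shift d G i k = G i (d ℕ.+ k)

  tupleProduct-empty : ∀ {r} (G : Fin r → ℕ → Carrier) → tupleProduct G (emptyTuple {r}) ≈ 1#
  tupleProduct-empty {zero}  G = refl
  tupleProduct-empty {suc r} G = trans (*-identityˡ _) (tupleProduct-empty (G ∘ Fin.suc))

  tupleProduct-zeros : ∀ {r m} (G : Fin r → ℕ → Carrier) (t : Vec (Vec Bool m) r) →
                       tupleProduct G (addColumn zeros t) ≈ tupleProduct (shift 1 G) t
  tupleProduct-zeros G []      = refl
  tupleProduct-zeros G (S ∷ t) = *-cong (*-identityˡ _) (tupleProduct-zeros (G ∘ Fin.suc) t)

  tupleProduct-unit : ∀ {r m} (G : Fin r → ℕ → Carrier) (i : Fin r) (t : Vec (Vec Bool m) r) →
                      tupleProduct G (addColumn (unit i) t) ≈ G i 0 * tupleProduct (shift 1 G) t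
  tupleProduct-unit G Fin.zero    (S ∷ t) =
    trans (*-assoc _ _ _) (*-congˡ (*-congˡ (tupleProduct-zeros (G ∘ Fin.suc) t)))
  tupleProduct-unit G (Fin.suc i) (S ∷ t) = begin
    (1# * rowProduct (G Fin.zero ∘ suc) S) * tupleProduct (G ∘ Fin.suc) (addColumn (unit i) t)
      ≈⟨ *-cong (*-identityˡ _) (tupleProduct-unit (G ∘ Fin.suc) i t) ⟩
    rowProduct (G Fin.zero ∘ suc) S * (G (Fin.suc i) 0 * tupleProduct (shift 1 (G ∘ Fin.suc)) t)
      ≈⟨ trans (sym (*-assoc _ _ _)) (trans (*-congʳ (*-comm _ _)) (*-assoc _ _ _)) ⟩
    G (Fin.suc i) 0 * (rowProduct (G Fin.zero ∘ suc) S * tupleProduct (shift 1 (G ∘ Fin.suc)) t) ∎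

  rowProduct-nonzero : ∀ {n} (g : ℕ → Carrier) → (∀ k → ¬ g k ≈ 0#) → (S : Vec Bool n) → ¬ rowProduct g S ≈ 0#
  rowProduct-nonzero g g≉0 []          = 1≉0
  rowProduct-nonzero g g≉0 (true  ∷ S) = nonzero-* (g≉0 0) (rowProduct-nonzero (g ∘ suc) (g≉0 ∘ suc) S)
  rowProduct-nonzero g g≉0 (false ∷ S) = nonzero-* 1≉0 (rowProduct-nonzero (g ∘ suc) (g≉0 ∘ suc) S)

  tupleProduct-nonzero : ∀ {r n} (G : Fin r → ℕ → Carrier) → (∀ i k → ¬ G i k ≈ 0#) → (𝐒 : Vec (Vec Bool n) r) →
                         ¬ tupleProduct G 𝐒 ≈ 0#
  tupleProduct-nonzero G G≉0 []      = 1≉0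
  tupleProduct-nonzero G G≉0 (S ∷ 𝐒) =
    nonzero-* (rowProduct-nonzero (G Fin.zero) (G≉0 Fin.zero) S) (tupleProduct-nonzero (G ∘ Fin.suc) (G≉0 ∘ Fin.suc) 𝐒)

  weight : ∀ {r n} → (Fin r → ℕ → Carrier) → (Fin r → ℕ → Carrier) → Vec (Vec Bool n) r → Carrier
  weight G H 𝐒 = tupleProduct G 𝐒 * (tupleProduct H 𝐒) ⁻¹

-- Weighted sums over P_r(n) and the recursion on the first element: the
-- element 0 is the first element of exactly one block, S_j + 0 for some j,
-- which covers {0,…,j}; removing it leaves a partition of {j+1,…,n-1}, so
--   E(n) = Σ_j [j < n] G_j(0)/H_j(0) · E^{(j+1)}(n-1-j),
-- where E^{(d)} is the partition sum for the weights shifted by d.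
module FirstElement {c ℓ} (F : Field c ℓ) (r : ℕ) where
  open Prelude
  open Partitions
  open import Data.Nat as ℕ using (ℕ; zero; suc; _∸_; _≤ᵇ_; _≡ᵇ_; _≤_; s≤s)
  import Data.Nat.Properties as ℕP
  open import Data.Bool using (Bool; true; false; _∧_)
  import Data.Bool.Properties as BoolP
  open import Data.Fin using (Fin; toℕ)
  open import Data.Vec using (Vec)
  open import Function using (_∘_)
  open import Relation.Nullary using (¬_; yes; no)
  open import Relation.Binary.PropositionalEquality as ≡ using (_≡_)

  open FieldFacts F
  open TupleSums F

  Weights : Set c
  Weights = Fin r → ℕ → Carrier

  NonVanishing : Weights → Set ℓ
  NonVanishing H = ∀ i k → ¬ H i k ≈ 0#

  shift-nonVanishing : ∀ d H → NonVanishing H → NonVanishing (shift d H)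
  shift-nonVanishing d H H≉0 i k = H≉0 i (d ℕ.+ k)

  fitSum : (ℕ → ℕ) → Weights → Weights → ℕ → Carrier
  fitSum p G H n = sumOver (λ 𝐒 → when (Fits p 𝐒) (weight G H 𝐒)) (allTuples r n)

  partitionSum : Weights → Weights → ℕ → Carrier
  partitionSum G H n = fitSum (prefix 0) G H n

  ratio : Weights → Weights → Fin r → ℕ → Carrier
  ratio G H k i = G k i * (H k i) ⁻¹

  -- Only the empty tuple partitions ∅.
  fitSum-zero : ∀ p G H → fitSum p G H 0 ≈ 1#
  fitSum-zero p G H = begin
    fitSum p G H 0                        ≈⟨ sumOver-allTuples-zero r (λ 𝐒 → when (Fits p 𝐒) (weight G H 𝐒)) ⟩
    when (Fits p ∅) (weight G H ∅)       ≈⟨ when-true (weight G H ∅) (Fits-empty {r} p) ⟩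
    tupleProduct G ∅ * (tupleProduct H ∅) ⁻¹
      ≈⟨ *-cong (tupleProduct-empty G) (⁻¹-cong (λ ΠH≈0 → 1≉0 (trans (sym (tupleProduct-empty H)) ΠH≈0))
                                                 (tupleProduct-empty H)) ⟩
    1# * 1# ⁻¹                           ≈⟨ trans (*-identityˡ _) 1⁻¹≈1 ⟩
    1#                                    ∎
    where ∅ = emptyTuple {r}

  partitionSum-zero : ∀ G H → partitionSum G H 0 ≈ 1#
  partitionSum-zero = fitSum-zero (prefix 0)

  module _ (G H : Weights) (H≉0 : NonVanishing H) where

    weight-zeros : ∀ {m} (t : Vec (Vec Bool m) r) → weight G H (addColumn zeros t) ≈ weight (shift 1 G) (shift 1 H) t
    weight-zeros t =
      *-cong (tupleProduct-zeros G t) (⁻¹-cong (tupleProduct-nonzero H H≉0 (addColumn zeros t)) (tupleProduct-zeros H t))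

    weight-unit : ∀ {m} (i : Fin r) (t : Vec (Vec Bool m) r) →
                  weight G H (addColumn (unit i) t) ≈ ratio G H i 0 * weight (shift 1 G) (shift 1 H) t
    weight-unit i t = begin
      tupleProduct G (addColumn (unit i) t) * (tupleProduct H (addColumn (unit i) t)) ⁻¹
        ≈⟨ *-cong (tupleProduct-unit G i t)
                  (⁻¹-cong (tupleProduct-nonzero H H≉0 (addColumn (unit i) t)) (tupleProduct-unit H i t)) ⟩
      (G i 0 * ΠG) * (H i 0 * ΠH) ⁻¹
        ≈⟨ *-congˡ (⁻¹-distrib-* (H≉0 i 0) (tupleProduct-nonzero (shift 1 H) (shift-nonVanishing 1 H H≉0) t)) ⟩
      (G i 0 * ΠG) * ((H i 0) ⁻¹ * ΠH ⁻¹)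
        ≈⟨ interchange-* (G i 0) ΠG _ _ ⟩
      ratio G H i 0 * weight (shift 1 G) (shift 1 H) t ∎
      where
      ΠG = tupleProduct (shift 1 G) t
      ΠH = tupleProduct (shift 1 H) t
      open import Algebra.Properties.CommutativeSemigroup *-commutativeSemigroup
        using () renaming (interchange to interchange-*)

    columnSum : (ℕ → ℕ) → (m : ℕ) → Vec Bool r → Carrier
    columnSum p m h = sumOver (λ t → when (Fits p (addColumn h t)) (weight G H (addColumn h t))) (allTuples r m)

    columnSum-split : ∀ p m h →
      columnSum p m h ≈ when (columnInRange m h ∧ ((ones h ℕ.+ p 0) ≡ᵇ 1))
                             (sumOver (λ t → when (Fits (λ k → p (suc k) ℕ.+ overhang h k) t) (weight G H (addColumn h t)))
                                      (allTuples r m))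
    columnSum-split p m h = begin
      columnSum p m h
        ≈⟨ sumOver-cong (allTuples r m) (λ t → trans (when-≡ _ (Fits-addColumn p h t)) (when-∧ B _ _)) ⟩
      sumOver (λ t → when B (when (Fits p' t) (weight G H (addColumn h t)))) (allTuples r m)
        ≈⟨ sumOver-when B _ (allTuples r m) ⟩
      when B (sumOver (λ t → when (Fits p' t) (weight G H (addColumn h t))) (allTuples r m)) ∎
      where
      B  = columnInRange m h ∧ ((ones h ℕ.+ p 0) ≡ᵇ 1)
      p' = λ k → p (suc k) ℕ.+ overhang h k

    -- Removing the column of 0: at most one block may contain 0.
    fitSum-suc : ∀ p m → fitSum p G H (suc m) ≈ columnSum p m zeros + sum (columnSum p m ∘ unit)
    fitSum-suc p m =
      trans (sumOver-allTuples-addColumn r m _) (sumOver-columns-atMostOne r (columnSum p m) (λ h 2≤ones →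
        trans (columnSum-split p m h) (when-false _ (≡.trans (≡.cong (columnInRange m h ∧_) (twice-covered 2≤ones))
                                                            (BoolP.∧-zeroʳ _)))))
      where
      twice-covered : ∀ {x} → 2 ≤ x → ((x ℕ.+ p 0) ≡ᵇ 1) ≡ false
      twice-covered (s≤s (s≤s _)) = ≡.refl

    -- 0 is already covered: it must lie in no block.
    columnSum-zeros : ∀ p m → columnSum p m zeros ≈ when (p 0 ≡ᵇ 1) (fitSum (p ∘ suc) (shift 1 G) (shift 1 H) m)
    columnSum-zeros p m = begin
      columnSum p m zeros
        ≈⟨ columnSum-split p m zeros ⟩
      when (columnInRange m (zeros {r}) ∧ ((ones (zeros {r}) ℕ.+ p 0) ≡ᵇ 1)) rest
        ≈⟨ when-≡ rest (≡.cong₂ (λ x y → x ∧ ((y ℕ.+ p 0) ≡ᵇ 1)) (columnInRange-zeros {r} m) (ones-zeros {r})) ⟩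
      when (p 0 ≡ᵇ 1) rest
        ≈⟨ when-cong (p 0 ≡ᵇ 1) (sumOver-cong (allTuples r m) (λ t →
             trans (when-≡ _ (Fits-cong t (λ k → ≡.trans (≡.cong (p (suc k) ℕ.+_) (overhang-zeros {r} k)) (ℕP.+-identityʳ _))))
                   (when-cong (Fits (p ∘ suc) t) (weight-zeros t)))) ⟩
      when (p 0 ≡ᵇ 1) (fitSum (p ∘ suc) (shift 1 G) (shift 1 H) m) ∎
      where
      rest = sumOver (λ t → when (Fits (λ k → p (suc k) ℕ.+ overhang (zeros {r}) k) t) (weight G H (addColumn zeros t)))
                     (allTuples r m)

    -- 0 lies in the single block S_i + 0 = {0,…,i}, which leaves the profile
    -- prefix i on the remaining elements.
    columnSum-unit : ∀ p m i →
      columnSum p m (unit i) ≈ when ((suc (toℕ i) ≤ᵇ suc m) ∧ ((1 ℕ.+ p 0) ≡ᵇ 1))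
                                    (ratio G H i 0 * fitSum (λ k → p (suc k) ℕ.+ prefix (toℕ i) k) (shift 1 G) (shift 1 H) m)
    columnSum-unit p m i = begin
      columnSum p m (unit i)
        ≈⟨ columnSum-split p m (unit i) ⟩
      when (columnInRange m (unit i) ∧ ((ones (unit i) ℕ.+ p 0) ≡ᵇ 1)) rest
        ≈⟨ when-≡ rest (≡.cong₂ (λ x y → x ∧ ((y ℕ.+ p 0) ≡ᵇ 1)) (columnInRange-unit m i) (ones-unit i)) ⟩
      when B rest
        ≈⟨ when-cong B (sumOver-cong (allTuples r m) (λ t →
             trans (when-≡ _ (Fits-cong t (λ k → ≡.cong (p (suc k) ℕ.+_) (overhang-unit i k))))
                   (trans (when-cong (Fits p' t) (weight-unit i t)) (sym (*-when (Fits p' t) (ratio G H i 0) _))))) ⟩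
      when B (sumOver (λ t → ratio G H i 0 * when (Fits p' t) (weight (shift 1 G) (shift 1 H) t)) (allTuples r m))
        ≈⟨ when-cong B (sym (*-distribˡ-sumOver (ratio G H i 0) _ (allTuples r m))) ⟩
      when B (ratio G H i 0 * fitSum p' (shift 1 G) (shift 1 H) m) ∎
      where
      B  = (suc (toℕ i) ≤ᵇ suc m) ∧ ((1 ℕ.+ p 0) ≡ᵇ 1)
      p' = λ k → p (suc k) ℕ.+ prefix (toℕ i) k
      rest = sumOver (λ t → when (Fits (λ k → p (suc k) ℕ.+ overhang (unit i) k) t) (weight G H (addColumn (unit i) t)))
                     (allTuples r m)

  -- With the first d+1 elements already covered, 0 lies in no block.
  fitSum-prefix-suc : ∀ d G H → NonVanishing H → ∀ m →
                      fitSum (prefix (suc d)) G H (suc m) ≈ fitSum (prefix d) (shift 1 G) (shift 1 H) m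
  fitSum-prefix-suc d G H H≉0 m = begin
    fitSum (prefix (suc d)) G H (suc m)
      ≈⟨ fitSum-suc G H H≉0 (prefix (suc d)) m ⟩
    columnSum G H H≉0 (prefix (suc d)) m zeros + sum (λ i → columnSum G H H≉0 (prefix (suc d)) m (unit i))
      ≈⟨ +-cong (columnSum-zeros G H H≉0 (prefix (suc d)) m)
                (sum-zero (λ i → trans (columnSum-unit G H H≉0 (prefix (suc d)) m i)
                                       (when-false _ (BoolP.∧-zeroʳ (suc (toℕ i) ≤ᵇ suc m))))) ⟩
    fitSum (prefix d) (shift 1 G) (shift 1 H) m + 0#
      ≈⟨ +-identityʳ _ ⟩
    fitSum (prefix d) (shift 1 G) (shift 1 H) m ∎

  fitSum-prefix : ∀ d G H → NonVanishing H → ∀ m → d ≤ m →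
                  fitSum (prefix d) G H m ≈ partitionSum (shift d G) (shift d H) (m ∸ d)
  fitSum-prefix zero    G H H≉0 m       _         = refl
  fitSum-prefix (suc d) G H H≉0 (suc m) (s≤s d≤m) =
    trans (fitSum-prefix-suc d G H H≉0 m) (fitSum-prefix d (shift 1 G) (shift 1 H) (shift-nonVanishing 1 H H≉0) m d≤m)

  firstTerm : Weights → Weights → ℕ → Fin r → Carrier
  firstTerm G H m j = when (toℕ j ≤ᵇ m) (ratio G H j 0 * partitionSum (shift (suc (toℕ j)) G) (shift (suc (toℕ j)) H) (m ∸ toℕ j))

  partitionSum-suc : ∀ G H → NonVanishing H → ∀ m → partitionSum G H (suc m) ≈ sum (firstTerm G H m)
  partitionSum-suc G H H≉0 m = begin
    partitionSum G H (suc m)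
      ≈⟨ fitSum-suc G H H≉0 (prefix 0) m ⟩
    columnSum G H H≉0 (prefix 0) m zeros + sum (λ i → columnSum G H H≉0 (prefix 0) m (unit i))
      ≈⟨ +-cong (columnSum-zeros G H H≉0 (prefix 0) m) (sum-cong (λ j → trans (columnSum-unit G H H≉0 (prefix 0) m j) (term j))) ⟩
    0# + sum (firstTerm G H m)
      ≈⟨ +-identityˡ _ ⟩
    sum (firstTerm G H m) ∎
    where
    term : ∀ j → when ((suc (toℕ j) ≤ᵇ suc m) ∧ true) (ratio G H j 0 * fitSum (prefix (toℕ j)) (shift 1 G) (shift 1 H) m)
                 ≈ firstTerm G H m j
    term j with toℕ j ℕP.≤? m
    ... | yes j≤m =
      trans (when-true _ (≡.trans (BoolP.∧-identityʳ _) (≡.trans (<ᵇ-suc (toℕ j) m) (≤ᵇ-true j≤m))))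
            (trans (*-congˡ (fitSum-prefix (toℕ j) (shift 1 G) (shift 1 H) (shift-nonVanishing 1 H H≉0) m j≤m))
                   (sym (when-true _ (≤ᵇ-true j≤m))))
    ... | no j≰m =
      trans (when-false _ (≡.trans (BoolP.∧-identityʳ _) (≡.trans (<ᵇ-suc (toℕ j) m) (≤ᵇ-false j≰m))))
            (sym (when-false _ (≤ᵇ-false j≰m)))

-- The recursion on the last element of {0,…,m}: the element m is the last
-- element of exactly one block S_k + (k-1), so removing that block gives
--   E(m+1) = Σ_k [k ≤ m] E(m-k) · G_k(m-k)/H_k(m-k).
-- It is derived from the first-element recursion by strong induction.
module LastElement {c ℓ} (F : Field c ℓ) (r : ℕ) where
  import Level
  open Prelude
  open import Data.Nat as ℕ using (ℕ; zero; suc; _∸_; _≤ᵇ_; _<ᵇ_; _≡ᵇ_; _≤_; _<_; z≤n; s≤s)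
  import Data.Nat.Properties as ℕP
  open import Data.Nat.Induction using (<-rec)
  open import Data.Bool using (T)
  open import Data.Fin using (Fin; toℕ)
  open import Data.Unit using (tt)
  open import Relation.Binary.PropositionalEquality as ≡ using (_≡_)
  open import Relation.Binary.Definitions using (tri<; tri≈; tri>)

  open FieldFacts F
  open TupleSums F
  open FirstElement F r

  ∸-suc-pred : ∀ {m j} → j < m → m ∸ j ≡ suc (m ∸ suc j)
  ∸-suc-pred {suc m} {zero}  _         = ≡.refl
  ∸-suc-pred {suc m} {suc j} (s≤s j<m) = ∸-suc-pred j<m

  ≤ᵇ-∸ : ∀ {m j} k → j < m → (k ≤ᵇ m ∸ suc j) ≡ (j ℕ.+ k <ᵇ m)
  ≤ᵇ-∸ {suc m} {zero}  k _         = ≡.sym (<ᵇ-suc k m)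
  ≤ᵇ-∸ {suc m} {suc j} k (s≤s j<m) = ≤ᵇ-∸ k j<m

  +-∸-suc : ∀ m j k → j ℕ.+ k < m → suc j ℕ.+ (m ∸ suc (j ℕ.+ k)) ≡ m ∸ k
  +-∸-suc m zero k k<m = ≡.sym (∸-suc-pred k<m)
  +-∸-suc (suc m) (suc j) k (s≤s jk<m) =
    ≡.trans (≡.cong suc (+-∸-suc m j k jk<m))
            (≡.sym (ℕP.+-∸-assoc 1 (ℕP.≤-trans (ℕP.m≤n+m k j) (ℕP.<⇒≤ jk<m))))

  ∸-suc-comm : ∀ m j k → (m ∸ suc k) ∸ j ≡ m ∸ suc (j ℕ.+ k)
  ∸-suc-comm m j k = ≡.trans (ℕP.∸-+-assoc m (suc k) j) (≡.cong (λ z → m ∸ suc z) (ℕP.+-comm k j))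

  lastTerm : Weights → Weights → ℕ → Fin r → Carrier
  lastTerm G H m k = when (toℕ k ≤ᵇ m) (partitionSum G H (m ∸ toℕ k) * ratio G H k (m ∸ toℕ k))

  LastElementRecursion : ℕ → Set (c Level.⊔ ℓ)
  LastElementRecursion m = ∀ G H → NonVanishing H → partitionSum G H (suc m) ≈ sum (lastTerm G H m)

  -- The contribution of the partitions of {0,…,m} in which 0 opens a block of
  -- S_j and m closes a different block, of S_k.
  crossTerm : Weights → Weights → ℕ → Fin r → Fin r → Carrier
  crossTerm G H m j k = when (toℕ j ℕ.+ toℕ k <ᵇ m)
    (ratio G H j 0 * (partitionSum (shift (suc (toℕ j)) G) (shift (suc (toℕ j)) H) (m ∸ suc (toℕ j ℕ.+ toℕ k))
                      * ratio G H k (m ∸ toℕ k)))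

  crossTerm-vanishes : ∀ G H m j k → m ≤ toℕ j ℕ.+ toℕ k → crossTerm G H m j k ≈ 0#
  crossTerm-vanishes G H m j k m≤j+k = when-false _ (<ᵇ-false (ℕP.≤⇒≯ m≤j+k))

  when-≤-split : ∀ i m {x y} a → (i ≡ m → x ≈ a) → (i < m → x ≈ y) → (m ≤ i → y ≈ 0#) →
                 when (i ≤ᵇ m) x ≈ when (i ≡ᵇ m) a + y
  when-≤-split i m {x} {y} a atEnd inside beyond with ℕP.<-cmp i m
  ... | tri< i<m _ _ = begin
    when (i ≤ᵇ m) x       ≈⟨ when-true x (≤ᵇ-true (ℕP.<⇒≤ i<m)) ⟩
    x                     ≈⟨ inside i<m ⟩
    y                     ≈⟨ sym (+-identityˡ y) ⟩
    0# + y                ≈⟨ +-congʳ (sym (when-false a (≡ᵇ-false (ℕP.<⇒≢ i<m)))) ⟩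
    when (i ≡ᵇ m) a + y   ∎
  ... | tri≈ _ ≡.refl _ = begin
    when (i ≤ᵇ i) x       ≈⟨ when-true x (≤ᵇ-true {i} {i} ℕP.≤-refl) ⟩
    x                     ≈⟨ atEnd ≡.refl ⟩
    a                     ≈⟨ sym (+-identityʳ a) ⟩
    a + 0#                ≈⟨ sym (+-cong (when-true a (≡ᵇ-true i)) (beyond ℕP.≤-refl)) ⟩
    when (i ≡ᵇ i) a + y   ∎
  ... | tri> _ _ m<i = begin
    when (i ≤ᵇ m) x       ≈⟨ when-false x (≤ᵇ-false (ℕP.<⇒≱ m<i)) ⟩
    0#                    ≈⟨ sym (+-identityʳ 0#) ⟩
    0# + 0#               ≈⟨ sym (+-cong (when-false a (≡ᵇ-false (λ i≡m → ℕP.<⇒≢ m<i (≡.sym i≡m))))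
                                         (beyond (ℕP.<⇒≤ m<i))) ⟩
    when (i ≡ᵇ m) a + y   ∎

  -- Expanding a term of the first-element recursion by the last-element
  -- recursion of the shorter partition (induction hypothesis).
  firstElement-expansion : ∀ m → (∀ {m'} → m' < m → LastElementRecursion m') → ∀ G H → NonVanishing H → ∀ j →
    firstTerm G H m j ≈ when (toℕ j ≡ᵇ m) (ratio G H j 0) + sum (crossTerm G H m j)
  firstElement-expansion m IH G H Hnz j = when-≤-split J m (ratio G H j 0) atEnd inside
    (λ m≤j → sum-zero (λ k → crossTerm-vanishes G H m j k (ℕP.≤-trans m≤j (ℕP.m≤m+n J (toℕ k)))))
    where
    J  = toℕ j
    G' = shift (suc J) G
    H' = shift (suc J) H
    a  = ratio G H j 0
    atEnd : J ≡ m → a * partitionSum G' H' (m ∸ J) ≈ a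
    atEnd ≡.refl =
      trans (*-congˡ (trans (reflexive (≡.cong (partitionSum G' H') (ℕP.n∸n≡0 J))) (partitionSum-zero G' H')))
            (*-identityʳ a)
    inside : J < m → a * partitionSum G' H' (m ∸ J) ≈ sum (crossTerm G H m j)
    inside j<m = begin
      a * partitionSum G' H' (m ∸ J)
        ≈⟨ *-congˡ (reflexive (≡.cong (partitionSum G' H') (∸-suc-pred j<m))) ⟩
      a * partitionSum G' H' (suc m')
        ≈⟨ *-congˡ (IH (ℕP.∸-monoʳ-< (s≤s z≤n) j<m) G' H' (shift-nonVanishing (suc J) H Hnz)) ⟩
      a * sum (λ k → when (toℕ k ≤ᵇ m') (partitionSum G' H' (m' ∸ toℕ k) * ratio G' H' k (m' ∸ toℕ k)))
        ≈⟨ *-distribˡ-sum {r} a _ ⟩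
      sum (λ k → a * when (toℕ k ≤ᵇ m') (partitionSum G' H' (m' ∸ toℕ k) * ratio G' H' k (m' ∸ toℕ k)))
        ≈⟨ sum-cong term ⟩
      sum (crossTerm G H m j) ∎
      where
      m' = m ∸ suc J
      term : ∀ k → a * when (toℕ k ≤ᵇ m') (partitionSum G' H' (m' ∸ toℕ k) * ratio G' H' k (m' ∸ toℕ k))
                   ≈ crossTerm G H m j k
      term k = trans (*-when _ a _) (trans (when-≡ _ (≤ᵇ-∸ (toℕ k) j<m)) (when-cong-if _ λ inRange →
        *-congˡ (*-cong (reflexive (≡.cong (partitionSum G' H') (ℕP.∸-+-assoc m (suc J) (toℕ k))))
                        (reflexive (≡.cong (ratio G H k)
                           (≡.trans (≡.cong (suc J ℕ.+_) (ℕP.∸-+-assoc m (suc J) (toℕ k)))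
                                    (+-∸-suc m J (toℕ k) (ℕP.<ᵇ⇒< _ _ (≡.subst T (≡.sym inRange) tt)))))))))

  -- Expanding a term of the last-element recursion by the first-element
  -- recursion of the shorter partition.
  lastElement-expansion : ∀ m G H → NonVanishing H → ∀ k →
    lastTerm G H m k ≈ when (toℕ k ≡ᵇ m) (ratio G H k 0) + sum (λ j → crossTerm G H m j k)
  lastElement-expansion m G H Hnz k = when-≤-split K m (ratio G H k 0) atEnd inside
    (λ m≤k → sum-zero (λ j → crossTerm-vanishes G H m j k (ℕP.≤-trans m≤k (ℕP.m≤n+m K (toℕ j)))))
    where
    K = toℕ k
    b = ratio G H k (m ∸ K)
    atEnd : K ≡ m → partitionSum G H (m ∸ K) * b ≈ ratio G H k 0
    atEnd ≡.refl =
      trans (reflexive (≡.cong (λ z → partitionSum G H z * ratio G H k z) (ℕP.n∸n≡0 K)))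
            (trans (*-congʳ (partitionSum-zero G H)) (*-identityˡ _))
    inside : K < m → partitionSum G H (m ∸ K) * b ≈ sum (λ j → crossTerm G H m j k)
    inside k<m = begin
      partitionSum G H (m ∸ K) * b
        ≈⟨ *-congʳ (reflexive (≡.cong (partitionSum G H) (∸-suc-pred k<m))) ⟩
      partitionSum G H (suc m') * b
        ≈⟨ *-congʳ (partitionSum-suc G H Hnz m') ⟩
      sum (λ j → when (toℕ j ≤ᵇ m') (ratio G H j 0 * E' j (m' ∸ toℕ j))) * b
        ≈⟨ *-distribʳ-sum {r} b _ ⟩
      sum (λ j → when (toℕ j ≤ᵇ m') (ratio G H j 0 * E' j (m' ∸ toℕ j)) * b)
        ≈⟨ sum-cong term ⟩
      sum (λ j → crossTerm G H m j k) ∎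
      where
      m' = m ∸ suc K
      E' : Fin r → ℕ → Carrier
      E' j = partitionSum (shift (suc (toℕ j)) G) (shift (suc (toℕ j)) H)
      term : ∀ j → when (toℕ j ≤ᵇ m') (ratio G H j 0 * E' j (m' ∸ toℕ j)) * b ≈ crossTerm G H m j k
      term j = trans (when-* _ b _)
        (trans (when-≡ _ (≡.trans (≤ᵇ-∸ (toℕ j) k<m) (≡.cong (_<ᵇ m) (ℕP.+-comm K (toℕ j)))))
               (when-cong _ (trans (*-assoc _ _ _)
                  (*-congˡ (*-congʳ (reflexive (≡.cong (E' j) (∸-suc-comm m (toℕ j) K))))))))

  partitionSum-last : ∀ m → LastElementRecursion m
  partitionSum-last = <-rec LastElementRecursion step
    where
    step : ∀ m → (∀ {m'} → m' < m → LastElementRecursion m') → LastElementRecursion m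
    step m IH G H Hnz = begin
      partitionSum G H (suc m)
        ≈⟨ partitionSum-suc G H Hnz m ⟩
      sum (firstTerm G H m)
        ≈⟨ sum-cong (firstElement-expansion m IH G H Hnz) ⟩
      sum (λ j → when (toℕ j ≡ᵇ m) (ratio G H j 0) + sum (crossTerm G H m j))
        ≈⟨ ∑-distrib-+ {r} _ _ ⟩
      sum (λ j → when (toℕ j ≡ᵇ m) (ratio G H j 0)) + sum (λ j → sum (crossTerm G H m j))
        ≈⟨ +-congˡ (∑-comm (crossTerm G H m)) ⟩
      sum (λ k → when (toℕ k ≡ᵇ m) (ratio G H k 0)) + sum (λ k → sum (λ j → crossTerm G H m j k))
        ≈⟨ sym (∑-distrib-+ {r} _ _) ⟩
      sum (λ k → when (toℕ k ≡ᵇ m) (ratio G H k 0) + sum (λ j → crossTerm G H m j k))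
        ≈⟨ sum-cong (λ k → sym (lastElement-expansion m G H Hnz k)) ⟩
      sum (lastTerm G H m) ∎

-- The sums over P_r(n) of the theorem are the partition sums of the weights
-- G_k(i) = A_k^{q^i}, H_k(i) = -[i+k]; by the last-element recursion they
-- satisfy the functional equation of the logarithm, T·log = log∘φ_T.
module LogCoefficients {c ℓ} (F : Field c ℓ) where
  open Prelude
  open Partitions
  open import Data.Nat as ℕ using (ℕ; zero; suc; _∸_; _≤ᵇ_; _≤_; z≤n; s≤s)
  import Data.Nat.Properties as ℕP
  import Data.Nat.ListAction as ℕList
  open import Data.Bool using (Bool; true; false)
  open import Data.Fin using (Fin; toℕ)
  open import Data.Vec using (Vec; []; _∷_)
  open import Data.List using (List; []; _∷_; map)
  import Data.List.Properties as LP
  open import Relation.Nullary using (¬_; yes; no)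
  import Relation.Binary.PropositionalEquality as ≡

  open FieldFacts F
  open TupleSums F

  prodL-elems : ∀ {n} (g : ℕ → Carrier) (row : Vec Bool n) → prodL (map g (elems row)) ≈ rowProduct g row
  prodL-elems g []            = refl
  prodL-elems g (true  ∷ row) =
    *-congˡ (trans (reflexive (≡.cong prodL (≡.sym (LP.map-∘ (elems row))))) (prodL-elems (λ i → g (suc i)) row))
  prodL-elems g (false ∷ row) =
    trans (reflexive (≡.cong prodL (≡.sym (LP.map-∘ (elems row)))))
          (trans (prodL-elems (λ i → g (suc i)) row) (sym (*-identityˡ _)))

  foldIdx-*-cong : ∀ {r} {X : Set} {g g' : Fin r → X → Carrier} (S : Vec X r) →
                   (∀ i x → g i x ≈ g' i x) → foldIdx _*_ 1# g S ≈ foldIdx _*_ 1# g' S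
  foldIdx-*-cong []      g≈g' = refl
  foldIdx-*-cong (x ∷ S) g≈g' = *-cong (g≈g' Fin.zero x) (foldIdx-*-cong S (λ i → g≈g' (Fin.suc i)))

  pow-sum : ∀ a (f : ℕ → ℕ) (L : List ℕ) → pow a (ℕList.sum (map f L)) ≈ prodL (map (λ i → pow a (f i)) L)
  pow-sum a f []      = refl
  pow-sum a f (x ∷ L) = trans (pow-+ a (f x) _) (*-congˡ (pow-sum a f L))

  Apow≈tupleProduct : ∀ {r n} q (A : Fin r → Carrier) (𝐒 : Vec (Vec Bool n) r) →
                      Apow q A 𝐒 ≈ tupleProduct (λ k i → pow (A k) (q ℕ.^ i)) 𝐒
  Apow≈tupleProduct q A 𝐒 =
    trans (reflexive (foldr-allFin _*_ 1# (λ k row → pow (A k) (w q row)) 𝐒))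
          (foldIdx-*-cong 𝐒 (λ k row → trans (pow-sum (A k) (q ℕ.^_) (elems row)) (prodL-elems _ row)))

  Lden≈tupleProduct : ∀ {r n} q T (𝐒 : Vec (Vec Bool n) r) →
                      Lden q T 𝐒 ≈ tupleProduct (λ k i → - bracket q T (i ℕ.+ suc (toℕ k))) 𝐒
  Lden≈tupleProduct q T 𝐒 =
    trans (reflexive (foldr-allFin _*_ 1# (λ k row → prodL (map (λ i → - bracket q T (i ℕ.+ suc (toℕ k))) (elems row))) 𝐒))
          (foldIdx-*-cong 𝐒 (λ k row → prodL-elems _ row))

  T-split : ∀ q T n → T ≈ pow T (q ℕ.^ n) + - bracket q T n
  T-split q T n = begin
    T                            ≈⟨ sym (+-identityˡ T) ⟩
    0# + T                       ≈⟨ +-congʳ (sym (-‿inverseʳ X)) ⟩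
    (X + - X) + T                ≈⟨ +-assoc X (- X) T ⟩
    X + (- X + T)                ≈⟨ +-congˡ (+-comm (- X) T) ⟩
    X + (T + - X)                ≈⟨ +-congˡ (sym (⁻¹-anti-homo‿- X T)) ⟩
    X + - (X + - T)              ∎
    where
    X = pow T (q ℕ.^ n)
    open import Algebra.Properties.AbelianGroup +-abelianGroup using (⁻¹-anti-homo‿-)

  module Coefficients (q : ℕ) (T : Carrier) (bracket≉0 : ∀ n → 1 ≤ n → ¬ (bracket q T n ≈ 0#))
                      (r : ℕ) (A : Fin r → Carrier) where

    open FirstElement F r
    open LastElement F r

    frob : ℕ → Carrier → Carrier
    frob m x = pow x (q ℕ.^ m)

    numerator : Weights
    numerator k i = frob i (A k)

    denominator : Weights
    denominator k i = - bracket q T (i ℕ.+ suc (toℕ k))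

    denominator-nonVanishing : NonVanishing denominator
    denominator-nonVanishing k i =
      nonzero-neg (bracket≉0 _ (ℕP.≤-trans (s≤s z≤n) (ℕP.m≤n+m (suc (toℕ k)) i)))

    logCoeff : ℕ → Carrier
    logCoeff = partitionSum numerator denominator

    logCoeff-zero : logCoeff 0 ≈ 1#
    logCoeff-zero = partitionSum-zero numerator denominator

    P-sum≈logCoeff : ∀ n → sumL (map (λ 𝐒 → Apow q A 𝐒 * (Lden q T 𝐒 ⁻¹)) (P r n)) ≈ logCoeff n
    P-sum≈logCoeff n =
      trans (sumOver-filter isInP _ (allTuples r n)) (sumOver-cong (allTuples r n) λ 𝐒 →
        trans (when-≡ _ (isInP≡Fits 𝐒)) (when-cong (Fits (prefix 0) 𝐒)
          (*-cong (Apow≈tupleProduct q A 𝐒)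
                  (⁻¹-cong (λ L≈0 → tupleProduct-nonzero denominator denominator-nonVanishing 𝐒
                                      (trans (sym (Lden≈tupleProduct q T 𝐒)) L≈0))
                           (Lden≈tupleProduct q T 𝐒)))))

    -- Σ_{i=1}^{min(r,n)} β_{n-i} A_i^{q^{n-i}}: the coefficient of z^{q^n} in
    -- log_φ(φ_T(z)) - Σ_m β_m T^{q^m} z^{q^m}
    logSummand : ℕ → Fin r → Carrier
    logSummand n k = when (suc (toℕ k) ≤ᵇ n) (logCoeff (n ∸ suc (toℕ k)) * frob (n ∸ suc (toℕ k)) (A k))

    logTail : ℕ → Carrier
    logTail n = sum (logSummand n)

    -- The functional equation T·log_φ(z) = log_φ(φ_T(z)), coefficientwise.
    logCoeff-functional-equation : ∀ n → T * logCoeff n ≈ logCoeff n * frob n T + logTail n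
    logCoeff-functional-equation zero = begin
      T * logCoeff 0                   ≈⟨ *-congˡ logCoeff-zero ⟩
      T * 1#                           ≈⟨ sym (*-identityˡ _) ⟩
      1# * (T * 1#)                    ≈⟨ *-congʳ (sym logCoeff-zero) ⟩
      logCoeff 0 * frob 0 T            ≈⟨ sym (+-identityʳ _) ⟩
      logCoeff 0 * frob 0 T + 0#       ≈⟨ +-congˡ (sym (sum-zero {r} (λ k → refl))) ⟩
      logCoeff 0 * frob 0 T + logTail 0 ∎
    logCoeff-functional-equation (suc m) = begin
      T * β                  ≈⟨ *-comm T β ⟩
      β * T                  ≈⟨ *-congˡ (T-split q T (suc m)) ⟩
      β * (frob (suc m) T + d) ≈⟨ distribˡ β _ d ⟩
      β * frob (suc m) T + β * d ≈⟨ +-congˡ β*d≈tail ⟩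
      β * frob (suc m) T + logTail (suc m) ∎
      where
      β = logCoeff (suc m)
      d = - bracket q T (suc m)
      d≉0 = nonzero-neg (bracket≉0 (suc m) (s≤s z≤n))
      -- each ratio in the last-element recursion has the denominator d
      term : ∀ k → lastTerm numerator denominator m k ≈ logSummand (suc m) k * d ⁻¹
      term k with toℕ k ℕP.≤? m
      ... | yes k≤m = begin
        lastTerm numerator denominator m k
          ≈⟨ when-true _ (≤ᵇ-true k≤m) ⟩
        logCoeff (m ∸ toℕ k) * (frob (m ∸ toℕ k) (A k) * (- bracket q T (m ∸ toℕ k ℕ.+ suc (toℕ k))) ⁻¹)
          ≈⟨ *-congˡ (*-congˡ (reflexive (≡.cong (λ z → (- bracket q T z) ⁻¹) m-k+k+1≡m+1))) ⟩
        logCoeff (m ∸ toℕ k) * (frob (m ∸ toℕ k) (A k) * d ⁻¹)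
          ≈⟨ sym (*-assoc _ _ _) ⟩
        (logCoeff (m ∸ toℕ k) * frob (m ∸ toℕ k) (A k)) * d ⁻¹
          ≈⟨ *-congʳ (sym (when-true _ (≤ᵇ-true (s≤s k≤m)))) ⟩
        logSummand (suc m) k * d ⁻¹ ∎
        where
        m-k+k+1≡m+1 = ≡.trans (ℕP.+-suc (m ∸ toℕ k) (toℕ k)) (≡.cong suc (ℕP.m∸n+n≡m k≤m))
      ... | no k≰m =
        trans (when-false _ (≤ᵇ-false k≰m))
              (sym (trans (*-congʳ (when-false _ (≤ᵇ-false (λ k+1≤m+1 → k≰m (ℕP.≤-pred k+1≤m+1))))) (zeroˡ _)))
      β*d≈tail : β * d ≈ logTail (suc m)
      β*d≈tail = begin
        β * d
          ≈⟨ *-congʳ (partitionSum-last m numerator denominator denominator-nonVanishing) ⟩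
        sum (lastTerm numerator denominator m) * d
          ≈⟨ *-congʳ (trans (sum-cong term) (sym (*-distribʳ-sum {r} (d ⁻¹) (logSummand (suc m))))) ⟩
        (logTail (suc m) * d ⁻¹) * d
          ≈⟨ div-mul-cancel d≉0 ⟩
        logTail (suc m) ∎

-- log_φ is the composition inverse of e_φ: the coefficients of the partition
-- sums satisfy the defining equations of IsCompInverse, and these equations
-- determine β uniquely once α₀ = 1.
module CompositionInverse {c ℓ} (F : Field c ℓ) where
  open Prelude
  open import Data.Nat as ℕ using (ℕ; zero; suc; _∸_; _≤ᵇ_; _<ᵇ_; _≡ᵇ_; _≤_; _<_; z≤n; s≤s)
  import Data.Nat.Properties as ℕP
  open import Data.Nat.Induction using (<-rec)
  open import Data.Nat.Primality using (Prime; prime⇒nonZero)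
  open import Data.Bool using (if_then_else_)
  open import Data.Fin using (Fin; toℕ)
  open import Data.List using (map; upTo; applyUpTo)
  import Data.List.Properties as LP
  open import Relation.Nullary using (¬_; yes; no)
  open import Relation.Binary.PropositionalEquality as ≡ using (_≡_)

  open FieldFacts F
  open import Algebra.Properties.Semiring.Mult semiring using (_×_)
  import Algebra.Properties.Ring ring as RingProperties

  -- The equation for n determines β_n from β_0,…,β_{n-1}, since its last
  -- term is β_n·α₀^{q^n} = β_n.
  compInverse-unique : ∀ q (α β β' : ℕ → Carrier) → α 0 ≈ 1# →
                       IsCompInverse q α β → IsCompInverse q α β' → ∀ n → β n ≈ β' n
  compInverse-unique q α β β' α₀≈1 inv inv' = <-rec (λ n → β n ≈ β' n) step
    where
    lastTerm : ∀ (b : ℕ → Carrier) n → b n * pow (α (n ∸ n)) (q ℕ.^ n) ≈ b n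
    lastTerm b n = trans (*-congˡ (trans (pow-cong (q ℕ.^ n) (trans (reflexive (≡.cong α (ℕP.n∸n≡0 n))) α₀≈1))
                                         (pow-1# (q ℕ.^ n))))
                         (*-identityʳ _)
    split : ∀ (b : ℕ → Carrier) → IsCompInverse q α b → ∀ n →
            sumBelow n (λ m → b m * pow (α (n ∸ m)) (q ℕ.^ m)) + b n ≈ (if n ≡ᵇ 0 then 1# else 0#)
    split b invᵇ n = trans (+-congˡ (sym (lastTerm b n))) (trans (sym (sumBelow-last n _)) (invᵇ n))
    step : ∀ n → (∀ {m} → m < n → β m ≈ β' m) → β n ≈ β' n
    step n IH = RingProperties.+-cancelˡ _ _ _ (trans (split β inv n) (trans (sym (split β' inv' n))
      (+-congʳ (sumBelow-cong n (λ m m<n → *-congʳ (sym (IH m<n)))))))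

  sumBelow-1# : ∀ n → sumBelow n (λ _ → 1#) ≈ n × 1#
  sumBelow-1# n = trans (reflexive (≡.cong sumL (LP.map-upTo (λ _ → 1#) n))) (go n)
    where
    go : ∀ n → sumL (applyUpTo (λ _ → 1#) n) ≈ n × 1#
    go zero    = refl
    go (suc n) = +-congˡ (go n)

  module Inverse (p e q : ℕ) (pp : Prime p) (q≡pᵉ : q ≡ p ℕ.^ e) (char : sumBelow p (λ _ → 1#) ≈ 0#)
                 (T : Carrier) (bracket≉0 : ∀ n → 1 ≤ n → ¬ (bracket q T n ≈ 0#))
                 (r : ℕ) (A : Fin r → Carrier)
                 (α : ℕ → Carrier) (α₀≈1 : α 0 ≈ 1#) (expEq : ExpEquation q T A α) where

    open LogCoefficients F
    open Coefficients q T bracket≉0 r A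
    open Binomial.Frobenius commutativeRing p pp
    open import Algebra.Properties.Semiring.Exp semiring using (_^_)

    -- The q^m-th power map is additive, since q^m is a power of the characteristic.
    q^m≡p^em : ∀ m → q ℕ.^ m ≡ p ℕ.^ (e ℕ.* m)
    q^m≡p^em m = ≡.trans (≡.cong (ℕ._^ m) q≡pᵉ) (ℕP.^-*-assoc p e m)

    frob-+ : ∀ m x y → frob m (x + y) ≈ frob m x + frob m y
    frob-+ m x y = begin
      frob m (x + y)                  ≈⟨ frob≈^ (x + y) ⟩
      (x + y) ^ pᵉᵐ                   ≈⟨ frobenius-additive-iterated p×1≈0 (e ℕ.* m) x y ⟩
      x ^ pᵉᵐ + y ^ pᵉᵐ               ≈⟨ sym (+-cong (frob≈^ x) (frob≈^ y)) ⟩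
      frob m x + frob m y             ∎
      where
      pᵉᵐ = p ℕ.^ (e ℕ.* m)
      frob≈^ : ∀ z → frob m z ≈ z ^ pᵉᵐ
      frob≈^ z = trans (pow-≡ z (q^m≡p^em m)) (pow≈^ z pᵉᵐ)
      p×1≈0 = trans (sym (sumBelow-1# p)) char

    frob-0# : ∀ m → frob m 0# ≈ 0#
    frob-0# m with q ℕ.^ m | ≡.subst (0 <_) (≡.sym (q^m≡p^em m)) (ℕP.m^n>0 p {{prime⇒nonZero pp}} (e ℕ.* m))
    ... | suc k | _ = zeroˡ _

    frob-when : ∀ m b x → frob m (when b x) ≈ when b (frob m x)
    frob-when m Data.Bool.true  x = refl
    frob-when m Data.Bool.false x = frob-0# m

    frob-sum : ∀ {k} m (f : Fin k → Carrier) → frob m (sum f) ≈ sum (λ i → frob m (f i))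
    frob-sum {zero}  m f = frob-0# m
    frob-sum {suc k} m f = trans (frob-+ m _ _) (+-congˡ (frob-sum m (λ i → f (Fin.suc i))))

    frob-frob : ∀ m j x → frob m (frob j x) ≈ frob (j ℕ.+ m) x
    frob-frob m j x = trans (pow-pow x (q ℕ.^ j) (q ℕ.^ m)) (pow-≡ x (≡.sym (ℕP.^-distribˡ-+-* q j m)))

    -- Σ_{i=1}^{min(r,k)} A_i α_{k-i}^{q^i}: the coefficient of z^{q^k} in
    -- φ_T(e_φ(z)) - T·e_φ(z)
    expSummand : ℕ → Fin r → Carrier
    expSummand k i = when (suc (toℕ i) ≤ᵇ k) (A i * frob (suc (toℕ i)) (α (k ∸ suc (toℕ i))))

    expTail : ℕ → Carrier
    expTail k = sum (expSummand k)

    expEquation : ∀ k → α k * frob k T ≈ T * α k + expTail k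
    expEquation k = trans (expEq k) (+-congˡ (sumOver-allFin (expSummand k)))

    frobExpSummand : ℕ → ℕ → Fin r → Carrier
    frobExpSummand m k i = when (suc (toℕ i) ≤ᵇ k) (frob m (A i) * frob (suc (toℕ i) ℕ.+ m) (α (k ∸ suc (toℕ i))))

    frob-expTail : ∀ m k → frob m (expTail k) ≈ sum (frobExpSummand m k)
    frob-expTail m k = trans (frob-sum m (expSummand k)) (sum-cong {r} λ i →
      trans (frob-when m (suc (toℕ i) ≤ᵇ k) _)
            (when-cong _ (trans (pow-* (A i) (frob (suc (toℕ i)) (α (k ∸ suc (toℕ i)))) (q ℕ.^ m))
                                (*-congˡ (frob-frob m (suc (toℕ i)) (α (k ∸ suc (toℕ i))))))))

    -- γ_n = Σ_{m≤n} β_m α_{n-m}^{q^m}: the coefficient of z^{q^n} in log_φ(e_φ(z))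
    γ : ℕ → Carrier
    γ n = sumBelow (suc n) (λ m → logCoeff m * frob m (α (n ∸ m)))

    module _ (n : ℕ) where

      frobα : ℕ → Carrier
      frobα m = frob m (α (n ∸ m))

      -- the part of both sides of γ_n·T^{q^n} = T·γ_n coming from the T-terms
      commonTerm : ℕ → Carrier
      commonTerm m = (logCoeff m * frob m T) * frobα m

      -- Applying Frob^m to the exponential equation in degree n - m.
      left-term : ∀ m → m < suc n →
                  (logCoeff m * frobα m) * frob n T ≈ commonTerm m + logCoeff m * frob m (expTail (n ∸ m))
      left-term m m<n+1 = begin
        (logCoeff m * frobα m) * frob n T                   ≈⟨ *-assoc _ _ _ ⟩
        logCoeff m * (frobα m * frob n T)                   ≈⟨ *-congˡ (*-congˡ frobT) ⟩
        logCoeff m * (frobα m * frob m (frob (n ∸ m) T))    ≈⟨ *-congˡ (sym (pow-* (α (n ∸ m)) _ (q ℕ.^ m))) ⟩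
        logCoeff m * frob m (α (n ∸ m) * frob (n ∸ m) T)    ≈⟨ *-congˡ (pow-cong (q ℕ.^ m) (expEquation (n ∸ m))) ⟩
        logCoeff m * frob m (T * α (n ∸ m) + expTail (n ∸ m))
          ≈⟨ *-congˡ (trans (frob-+ m _ _) (+-congʳ (pow-* T (α (n ∸ m)) (q ℕ.^ m)))) ⟩
        logCoeff m * (frob m T * frobα m + frob m (expTail (n ∸ m)))
          ≈⟨ trans (distribˡ _ _ _) (+-congʳ (sym (*-assoc _ _ _))) ⟩
        commonTerm m + logCoeff m * frob m (expTail (n ∸ m)) ∎
        where
        frobT : frob n T ≈ frob m (frob (n ∸ m) T)
        frobT = sym (trans (frob-frob m (n ∸ m) T) (pow-≡ T (≡.cong (q ℕ.^_) (ℕP.m∸n+n≡m (ℕP.≤-pred m<n+1)))))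

      -- Multiplying the logarithm equation in degree m by α_{n-m}^{q^m}.
      right-term : ∀ m → T * (logCoeff m * frobα m) ≈ commonTerm m + logTail m * frobα m
      right-term m = trans (sym (*-assoc _ _ _)) (trans (*-congʳ (logCoeff-functional-equation m)) (distribʳ _ _ _))

      -- Both remaining double sums are Σ over m + i + 1 ≤ n of
      -- β_m A_i^{q^m} α_{n-m-i-1}^{q^{m+i+1}}; the log side needs the reindexing m ↦ m + i + 1.
      expTerm : ℕ → Fin r → Carrier
      expTerm m i = when (suc (toℕ i) ≤ᵇ n ∸ m)
        (logCoeff m * (frob m (A i) * frob (suc (toℕ i) ℕ.+ m) (α (n ∸ m ∸ suc (toℕ i)))))

      logTerm : ℕ → Fin r → Carrier
      logTerm m i = when (suc (toℕ i) ≤ᵇ m)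
        ((logCoeff (m ∸ suc (toℕ i)) * frob (m ∸ suc (toℕ i)) (A i)) * frobα m)

      logTerm≈expTerm : ∀ i → sumBelow (suc n) (λ m → logTerm m i) ≈ sumBelow (suc n) (λ m → expTerm m i)
      logTerm≈expTerm i = begin
        sumBelow (suc n) (λ m → logTerm m i)                    ≈⟨ sumBelow-cong (suc n) (λ m _ → shifted m) ⟩
        sumBelow (suc n) (λ m → when (d ≤ᵇ m) (g (m ∸ d)))      ≈⟨ sumBelow-reindex (suc n) d g ⟩
        sumBelow (suc n) (λ m → when (m ℕ.+ d <ᵇ suc n) (g m))
          ≈⟨ sumBelow-cong (suc n) (λ m _ → when-≡ _ (≡.trans (<ᵇ-suc (m ℕ.+ d) n) (+-≤ᵇ-∸ m (toℕ i) n))) ⟩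
        sumBelow (suc n) (λ m → expTerm m i)                    ∎
        where
        d = suc (toℕ i)
        g : ℕ → Carrier
        g j = logCoeff j * (frob j (A i) * frob (d ℕ.+ j) (α (n ∸ j ∸ d)))
        shifted : ∀ m → logTerm m i ≈ when (d ≤ᵇ m) (g (m ∸ d))
        shifted m with d ℕP.≤? m
        ... | no d≰m  = trans (when-false _ (≤ᵇ-false d≰m)) (sym (when-false _ (≤ᵇ-false d≰m)))
        ... | yes d≤m = trans (when-true _ (≤ᵇ-true d≤m)) (trans (trans (*-assoc _ _ _) (*-congˡ (*-congˡ
                (reflexive (≡.cong₂ (λ u v → pow (α u) (q ℕ.^ v))
                   (≡.sym (≡.trans (ℕP.∸-+-assoc n (m ∸ d) d) (≡.cong (n ∸_) (ℕP.m∸n+n≡m d≤m))))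
                   (≡.sym (ℕP.m+[n∸m]≡n d≤m)))))))
                (sym (when-true _ (≤ᵇ-true d≤m))))

      tails-agree : sumBelow (suc n) (λ m → logCoeff m * frob m (expTail (n ∸ m)))
                    ≈ sumBelow (suc n) (λ m → logTail m * frobα m)
      tails-agree = begin
        sumBelow (suc n) (λ m → logCoeff m * frob m (expTail (n ∸ m)))
          ≈⟨ sumBelow-cong (suc n) (λ m _ → trans (*-congˡ (frob-expTail m (n ∸ m)))
                (trans (*-distribˡ-sum {r} (logCoeff m) (frobExpSummand m (n ∸ m)))
                       (sum-cong {r} (λ i → *-when _ (logCoeff m) _)))) ⟩
        sumBelow (suc n) (λ m → sum (expTerm m))     ≈⟨ sumBelow-sum-comm (suc n) expTerm ⟩
        sum (λ i → sumBelow (suc n) (λ m → expTerm m i)) ≈⟨ sum-cong (λ i → sym (logTerm≈expTerm i)) ⟩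
        sum (λ i → sumBelow (suc n) (λ m → logTerm m i)) ≈⟨ sym (sumBelow-sum-comm (suc n) logTerm) ⟩
        sumBelow (suc n) (λ m → sum (logTerm m))
          ≈⟨ sumBelow-cong (suc n) (λ m _ → sym (trans (*-distribʳ-sum {r} (frobα m) (logSummand m))
                                                       (sum-cong {r} (λ i → when-* _ (frobα m) _)))) ⟩
        sumBelow (suc n) (λ m → logTail m * frobα m) ∎

      -- Coefficient of z^{q^n} in log_φ(e_φ(Tz)) = log_φ(φ_T(e_φ(z))) = T·log_φ(e_φ(z)).
      γ-commutes : γ n * frob n T ≈ T * γ n
      γ-commutes = begin
        γ n * frob n T                                        ≈⟨ *-distribʳ-sumOver _ _ (upTo (suc n)) ⟩
        sumBelow (suc n) (λ m → (logCoeff m * frobα m) * frob n T) ≈⟨ sumBelow-cong (suc n) left-term ⟩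
        sumBelow (suc n) (λ m → commonTerm m + logCoeff m * frob m (expTail (n ∸ m)))
          ≈⟨ trans (sumOver-+ _ _ (upTo (suc n))) (+-congˡ tails-agree) ⟩
        sumBelow (suc n) commonTerm + sumBelow (suc n) (λ m → logTail m * frobα m)
          ≈⟨ sym (sumOver-+ _ _ (upTo (suc n))) ⟩
        sumBelow (suc n) (λ m → commonTerm m + logTail m * frobα m)
          ≈⟨ sumBelow-cong (suc n) (λ m _ → sym (right-term m)) ⟩
        sumBelow (suc n) (λ m → T * (logCoeff m * frobα m))  ≈⟨ sym (*-distribˡ-sumOver _ _ (upTo (suc n))) ⟩
        T * γ n                                               ∎

    γ₀≈1 : γ 0 ≈ 1#
    γ₀≈1 = trans (+-identityʳ _) (trans (*-cong logCoeff-zero (trans (*-identityʳ _) α₀≈1))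
                                        (*-identityˡ 1#))

    -- (T^{q^n} - T)·γ_n = 0 and [n] ≠ 0 for n ≥ 1.
    γ-suc≈0 : ∀ n → γ (suc n) ≈ 0#
    γ-suc≈0 n = cancel-nonzero (bracket≉0 (suc n) (s≤s z≤n)) (begin
      g * (frob (suc n) T + - T)       ≈⟨ distribˡ _ _ _ ⟩
      g * frob (suc n) T + g * - T     ≈⟨ +-cong (γ-commutes (suc n)) (sym (RingProperties.-‿distribʳ-* g T)) ⟩
      T * g + - (g * T)                ≈⟨ +-congʳ (*-comm T g) ⟩
      g * T + - (g * T)                ≈⟨ -‿inverseʳ _ ⟩
      0#                               ∎)
      where g = γ (suc n)

    logCoeff-compInverse : IsCompInverse q α logCoeff
    logCoeff-compInverse zero    = γ₀≈1
    logCoeff-compInverse (suc n) = γ-suc≈0 n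

open import Data.Nat using (suc; _≤_; _^_)
open import Data.Nat.Primality using (Prime)
open import Data.Fin using (Fin; toℕ)
open import Data.List using (map)
open import Relation.Nullary using (¬_)
open import Relation.Binary.PropositionalEquality using (_≡_)

-- β is the composition inverse of e_φ, and so are the sums over P_r(n).
theorem3p3 : ∀ {c ℓ} (F : Field c ℓ) →
    let open Field F
        open RingNotions commutativeRing
    in (p e q : ℕ) → Prime p → 1 ≤ e → q ≡ p ^ e →
       sumBelow p (λ _ → 1#) ≈ 0# →
       (T : Carrier) → (∀ n → 1 ≤ n → ¬ (bracket q T n ≈ 0#)) →
       (r : ℕ) → 1 ≤ r → (A : Fin r → Carrier) →
       (∀ idx → suc (toℕ idx) ≡ r → ¬ (A idx ≈ 0#)) →
       (α β : ℕ → Carrier) → α 0 ≈ 1# → ExpEquation q T A α →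
       IsCompInverse q α β →
       ∀ n → β n ≈ sumL (map (λ 𝐒 → Apow q A 𝐒 * (Lden q T 𝐒 ⁻¹)) (P r n))
theorem3p3 F p e q p-prime _ q≡pᵉ char T bracket≉0 r _ A _ α β α₀≈1 expEq β-inverse n = begin
  β n         ≈⟨ compInverse-unique q α β logCoeff α₀≈1 β-inverse logCoeff-compInverse n ⟩
  logCoeff n  ≈⟨ sym (P-sum≈logCoeff n) ⟩
  sumL (map (λ 𝐒 → Apow q A 𝐒 * (Lden q T 𝐒 ⁻¹)) (P r n)) ∎
  where
  open FieldFacts F
  open LogCoefficients.Coefficients F q T bracket≉0 r A
  open CompositionInverse F
  open Inverse p e q p-prime q≡pᵉ char T bracket≉0 r A α α₀≈1 expEq
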